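{- Fix integers $a,b$ with $0\le a<b$ and set $c=a+b$. For $n\ge0$ let $p_n=(cn+b-a-1,\,2n)$ and $q_n=(cn+b-1,\,2n+1)$. Let $\mathscr{P}^{a,b}_n$ and $\mathscr{Q}^{a,b}_n$ be the sets of lattice paths from the origin to $p_n$ and $q_n$, respectively, lying weakly under $\partial_{a,b}$, and define $\mathscr{P}^{b,a}_n,\mathscr{Q}^{b,a}_n$ similarly with $\partial_{b,a}$. Then $$|\mathscr{Q}^{a,b}_n|=M_n,\qquad |\mathscr{Q}^{b,a}_n|=0,$$ $$|\mathscr{P}^{a,b}_n|=N_n+\frac12\sum_{i=0}^{n-1}M_iM_{n-1-i},\qquad |\mathscr{P}^{b,a}_n|=N_n-\frac12\sum_{i=0}^{n-1}M_iM_{n-1-i},$$ where $$M_n=\frac{b-a}{cn+b}\binom{(c+2)n+b}{2n+1},\qquad N_n=\frac{b-a}{cn+b-a}\binom{(c+2)n+b-a-1}{2n}.$$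
   Context: Lattice paths use unit steps $(0,1)$ and $(1,0)$. For nonnegative integers $u,v$, $\partial_{u,v}$ is the boundary curve $x=g_{u,v}(y)$, $y\ge0$, where $g_{u,v}$ is the continuous piecewise linear function with $g_{u,v}(0)=0$, slope $dx/dy=u$ on each interval $[2r,2r+1]$ and slope $v$ on each interval $[2r+1,2r+2]$, $r\ge0$ (i.e. the boundary of the periodic sequence $(u,v,u,v,\ldots)$). A lattice path from the origin lies weakly under $\partial_{u,v}$ if each of its lattice points $(x,y)$ satisfies $x\ge g_{u,v}(y)$. -}

module Defs where

open import Data.Nat using (ℕ; zero; suc; _+_; _*_; _∸_; _≤_)
open import Data.Nat.Combinatorics using (_C_)
open import Data.Integer using (+_)
open import Data.Rational using (ℚ; _/_; 0ℚ) renaming (_+_ to _+ℚ_; _*_ to _*ℚ_)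
open import Data.List using (List; []; _∷_; inits; upTo; foldr; map)
open import Data.List.Relation.Unary.All using (All)
open import Data.Product using (Σ; ∃-syntax; _×_; _,_; proj₁; proj₂)
open import Data.Fin using (Fin)
open import Function.Bundles using (_↔_)
open import Relation.Binary.PropositionalEquality using (_≡_)

data Step : Set where
  E N : Step

endpoint : List Step → ℕ × ℕ
endpoint [] = 0 , 0
endpoint (E ∷ p) = let (x , y) = endpoint p in suc x , y
endpoint (N ∷ p) = let (x , y) = endpoint p in x , suc y

-- The lattice points of a path p are the endpoints of its prefixes (inits p).

-- g u v y for integer y: g(0) = 0, slope u on [2r,2r+1], slope v on [2r+1,2r+2].
-- Recursively: g_{u,v}(y+1) = u + g_{v,u}(y).
g : ℕ → ℕ → ℕ → ℕ
g u v zero = zero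
g u v (suc y) = u + g v u y

WeaklyUnder : ℕ → ℕ → List Step → Set
WeaklyUnder u v p = All (λ q → g u v (proj₂ (endpoint q)) ≤ proj₁ (endpoint q)) (inits p)

Paths : ℕ → ℕ → ℕ → ℕ → Set
Paths u v X Y = Σ (List Step) (λ p → WeaklyUnder u v p × endpoint p ≡ (X , Y))

ℕtoℚ : ℕ → ℚ
ℕtoℚ k = + k / 1

HasCard : Set → ℚ → Set
HasCard A q = ∃[ k ] ((Fin k ↔ A) × ℕtoℚ k ≡ q)

-- Total division of a natural by a natural (denominator 0 ↦ 0; never used with 0 here).
_÷ℕ_ : ℕ → ℕ → ℚ
m ÷ℕ zero = 0ℚ
m ÷ℕ suc d = + m / suc d

sumℚ : List ℚ → ℚ
sumℚ = foldr _+ℚ_ 0ℚ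

M : ℕ → ℕ → ℕ → ℚ
M a b n = let c = a + b in
  ((b ∸ a) ÷ℕ (c * n + b)) *ℚ ℕtoℚ (((c + 2) * n + b) C (2 * n + 1))

Nn : ℕ → ℕ → ℕ → ℚ
Nn a b n = let c = a + b in
  ((b ∸ a) ÷ℕ (c * n + b ∸ a)) *ℚ ℕtoℚ (((c + 2) * n + b ∸ a ∸ 1) C (2 * n))

convM : ℕ → ℕ → ℕ → ℚ
convM a b n = sumℚ (map (λ i → M a b i *ℚ M a b (n ∸ 1 ∸ i)) (upTo n))

module Submission where

-- Labelling the word by weights u, v (E ↦ up-step,
-- the successive N-steps ↦ down-steps of weights u, v, u, …) turns "weakly under ∂_{u,v}" into
-- "the labelled walk started at height 1 stays at height ≥ 1 after every down-step"
-- (paths↔words), and counting paths into sums Σw over all words of a given length.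
--
-- 1. The cycle lemma (cycleLemma): a word of up-steps and weighted down-steps whose up-steps
--    exceed its total down-weight by s ≥ 1 has exactly s good cyclic rotations.
-- 2. Labelling commutes with rotation up to swapping the weights when the number of N-steps is
--    even (rotations-even); for an odd number, doubling the word reduces to the even case and
--    only the labelling by a, b survives (rotations-odd).  Averaging over rotation classes and an
--    absorption identity for binomials give the closed forms #Q-closed (= M_n) and #P-closed
--    (= 2 N_n for the sum of both counts of paths to p_n).
-- 3. First-violation decomposition (FixedWeights): a path to p_n under ∂_{a,b} either lies under
--    ∂_{b,a} or splits at its first violation into a path to q_r and, after an E-step, a path
--    to q_{n-1-r}; hence |P^{a,b}_n| = |P^{b,a}_n| + Σ_r M_r M_{n-1-r}.
-- 4. Solving the two linear relations over ℚ gives the four counts of theorem4; no path to q_n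
--    lies under ∂_{b,a} because its labelled walk would end exactly at height 0.

open import Defs
open import Data.Nat
open import Data.Nat.Properties
open import Data.Nat.Combinatorics using (_C_; nCk+nC[k+1]≡[n+1]C[k+1])
open import Data.Nat.Tactic.RingSolver using (solve-∀)
open import Data.Bool using (Bool; true; false; _∧_; T)
open import Data.Bool.Properties using (T-≡; T-irrelevant; ∧-conicalˡ; ∧-conicalʳ; ∧-assoc; ∧-zeroʳ)
open import Data.List using (List; []; _∷_; _++_; [_]; length; take; drop; inits; map; upTo; applyUpTo)
open import Data.List.Properties using (++-assoc; length-++; ++-identityʳ; length-take; take++drop≡id)
open import Data.List.Relation.Unary.All using (All; []; _∷_)
import Data.List.Relation.Unary.All as All
open import Data.List.Relation.Unary.All.Properties using (map⁺; map⁻)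
open import Data.Product using (Σ; _×_; _,_; proj₁; proj₂)
open import Data.Product.Properties using (≡-dec)
open import Data.Sum using (_⊎_; inj₁; inj₂)
open import Data.Sum.Function.Propositional using (_⊎-↔_)
open import Data.Fin using (Fin; zero)
open import Data.Fin.Properties using (+↔⊎)
open import Data.Unit using (tt)
open import Data.Empty using (⊥; ⊥-elim)
import Data.Integer as ℤ
import Data.Integer.Properties as ℤP
open import Data.Rational using (ℚ; ½; 0ℚ; fromℚᵘ) renaming (_+_ to _+ℚ_; _-_ to _-ℚ_; _*_ to _*ℚ_)
import Data.Rational as ℚ
import Data.Rational.Properties as ℚP
open import Data.Rational.Unnormalised using (ℚᵘ; mkℚᵘ; *≡*)
import Data.Rational.Unnormalised as ℚᵘ
import Data.Rational.Unnormalised.Properties as ℚᵘP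
open import Function using (id)
open import Function.Bundles using (Equivalence; _⇔_; mk⇔; _↔_; mk↔ₛ′)
open import Function.Properties.Inverse using (↔-trans)
open import Relation.Nullary using (yes; no)
open import Relation.Binary.Definitions using (tri<; tri≈; tri>)
open import Relation.Binary.PropositionalEquality hiding ([_])
open import Axiom.UniquenessOfIdentityProofs using (module Decidable⇒UIP)
import Algebra.Properties.CommutativeSemigroup as CommSemigroupProperties
open CommSemigroupProperties +-commutativeSemigroup using () renaming (interchange to +-interchange)
open CommSemigroupProperties *-commutativeSemigroup using () renaming (x∙yz≈y∙xz to *-left-comm)

Σ< : ℕ → (ℕ → ℕ) → ℕ
Σ< zero h = 0
Σ< (suc k) h = Σ< k h + h k

Σ<-cong : ∀ k {h h' : ℕ → ℕ} → (∀ i → i < k → h i ≡ h' i) → Σ< k h ≡ Σ< k h'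
Σ<-cong zero eq = refl
Σ<-cong (suc k) eq = cong₂ _+_ (Σ<-cong k (λ i i<k → eq i (m<n⇒m<1+n i<k))) (eq k ≤-refl)

Σ<-split : ∀ k₁ k₂ h → Σ< (k₁ + k₂) h ≡ Σ< k₁ h + Σ< k₂ (λ j → h (k₁ + j))
Σ<-split k₁ zero h = trans (cong (λ k → Σ< k h) (+-identityʳ k₁)) (sym (+-identityʳ _))
Σ<-split k₁ (suc k₂) h = begin
    Σ< (k₁ + suc k₂) h                                  ≡⟨ cong (λ k → Σ< k h) (+-suc k₁ k₂) ⟩
    Σ< (k₁ + k₂) h + h (k₁ + k₂)                        ≡⟨ cong (_+ h (k₁ + k₂)) (Σ<-split k₁ k₂ h) ⟩
    (Σ< k₁ h + Σ< k₂ (λ j → h (k₁ + j))) + h (k₁ + k₂)  ≡⟨ +-assoc (Σ< k₁ h) _ _ ⟩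
    Σ< k₁ h + (Σ< k₂ (λ j → h (k₁ + j)) + h (k₁ + k₂))  ∎
  where open ≡-Reasoning

Σ<-cons : ∀ k h → Σ< (suc k) h ≡ h 0 + Σ< k (λ j → h (suc j))
Σ<-cons k h = Σ<-split 1 k h

Σ<-const : ∀ k c → Σ< k (λ _ → c) ≡ k * c
Σ<-const zero c = refl
Σ<-const (suc k) c = trans (cong (_+ c) (Σ<-const k c)) (+-comm (k * c) c)

Σ<-zero : ∀ k {h} → (∀ i → i < k → h i ≡ 0) → Σ< k h ≡ 0
Σ<-zero k eq = trans (Σ<-cong k eq) (trans (Σ<-const k 0) (*-zeroʳ k))

Σ<-+ : ∀ k f h → Σ< k (λ i → f i + h i) ≡ Σ< k f + Σ< k h
Σ<-+ zero f h = refl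
Σ<-+ (suc k) f h = trans (cong (_+ (f k + h k)) (Σ<-+ k f h)) (+-interchange (Σ< k f) (Σ< k h) (f k) (h k))

Σ<-periodic : ∀ n h → (∀ j → h (n + j) ≡ h j) → Σ< (n + n) h ≡ Σ< n h + Σ< n h
Σ<-periodic n h periodic = trans (Σ<-split n n h) (cong (Σ< n h +_) (Σ<-cong n (λ j _ → periodic j)))

Σ<-* : ∀ k c f → Σ< k (λ i → c * f i) ≡ c * Σ< k f
Σ<-* zero c f = sym (*-zeroʳ c)
Σ<-* (suc k) c f = trans (cong (_+ c * f k) (Σ<-* k c f)) (sym (*-distribˡ-+ c (Σ< k f) (f k)))

rotate : ∀ {A : Set} → List A → List A
rotate [] = []
rotate (x ∷ xs) = xs ++ [ x ]

rotateBy : ∀ {A : Set} → ℕ → List A → List A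
rotateBy zero xs = xs
rotateBy (suc k) xs = rotateBy k (rotate xs)

rotateBy-++ : ∀ {A : Set} (p q : List A) → rotateBy (length p) (p ++ q) ≡ q ++ p
rotateBy-++ [] q = sym (++-identityʳ q)
rotateBy-++ (x ∷ p) q = begin
  rotateBy (length p) ((p ++ q) ++ [ x ]) ≡⟨ cong (rotateBy (length p)) (++-assoc p q [ x ]) ⟩
  rotateBy (length p) (p ++ q ++ [ x ])   ≡⟨ rotateBy-++ p (q ++ [ x ]) ⟩
  (q ++ [ x ]) ++ p                       ≡⟨ ++-assoc q [ x ] p ⟩
  q ++ x ∷ p                              ∎
  where open ≡-Reasoning

rotateBy-factor : ∀ {A : Set} {xs : List A} p x q → xs ≡ p ++ x ∷ q → rotateBy (length p) xs ≡ x ∷ q ++ p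
rotateBy-factor p x q refl = rotateBy-++ p (x ∷ q)

rotateBy-+ : ∀ {A : Set} i j (xs : List A) → rotateBy (i + j) xs ≡ rotateBy j (rotateBy i xs)
rotateBy-+ zero j xs = refl
rotateBy-+ (suc i) j xs = rotateBy-+ i j (rotate xs)

rotateBy-length : ∀ {A : Set} (xs : List A) → rotateBy (length xs) xs ≡ xs
rotateBy-length xs = trans (cong (rotateBy (length xs)) (sym (++-identityʳ xs))) (rotateBy-++ xs [])

length-rotateBy : ∀ {A : Set} k (xs : List A) → length (rotateBy k xs) ≡ length xs
length-rotateBy zero xs = refl
length-rotateBy (suc k) [] = length-rotateBy k []
length-rotateBy (suc k) (x ∷ xs) = trans (length-rotateBy k (xs ++ [ x ])) (trans (length-++ xs) (+-comm (length xs) 1))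

module Additive {A : Set} (f : List A → ℕ) (f-++ : ∀ p q → f (p ++ q) ≡ f p + f q) where

  f-rotate : ∀ xs → f (rotate xs) ≡ f xs
  f-rotate [] = refl
  f-rotate (x ∷ xs) = trans (f-++ xs [ x ]) (trans (+-comm (f xs) (f [ x ])) (sym (f-++ [ x ] xs)))

  f-rotateBy : ∀ k xs → f (rotateBy k xs) ≡ f xs
  f-rotateBy zero xs = refl
  f-rotateBy (suc k) xs = trans (f-rotateBy k (rotate xs)) (f-rotate xs)

<ᵇ⇒≡true : ∀ {m n} → m < n → (m <ᵇ n) ≡ true
<ᵇ⇒≡true m<n = Equivalence.to T-≡ (<⇒<ᵇ m<n)

≡true⇒< : ∀ {m n} → (m <ᵇ n) ≡ true → m < n
≡true⇒< {m} {n} h = <ᵇ⇒< m n (Equivalence.from T-≡ h)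

≡true⇒≡ : ∀ {m n} → (m ≡ᵇ n) ≡ true → m ≡ n
≡true⇒≡ {m} {n} h = ≡ᵇ⇒≡ m n (Equivalence.from T-≡ h)

≡⇒≡true : ∀ {m n} → m ≡ n → (m ≡ᵇ n) ≡ true
≡⇒≡true {m} {n} m≡n = Equivalence.to T-≡ (≡⇒≡ᵇ m n m≡n)

-- Łukasiewicz-type words: an up-step raises the height by one, a down-step of weight w lowers it by w.
data Letter : Set where
  up : Letter
  down : ℕ → Letter

positiveFrom : ℕ → List Letter → Bool
positiveFrom h [] = true
positiveFrom h (up ∷ xs) = positiveFrom (suc h) xs
positiveFrom h (down w ∷ xs) = (w <ᵇ h) ∧ positiveFrom (h ∸ w) xs

𝟙 : Bool → ℕ
𝟙 true = 1
𝟙 false = 0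

#up : List Letter → ℕ
#up [] = 0
#up (up ∷ xs) = suc (#up xs)
#up (down _ ∷ xs) = #up xs

#down : List Letter → ℕ
#down [] = 0
#down (up ∷ xs) = #down xs
#down (down _ ∷ xs) = suc (#down xs)

weight : List Letter → ℕ
weight [] = 0
weight (up ∷ xs) = weight xs
weight (down w ∷ xs) = w + weight xs

#up-++ : ∀ p q → #up (p ++ q) ≡ #up p + #up q
#up-++ [] q = refl
#up-++ (up ∷ p) q = cong suc (#up-++ p q)
#up-++ (down _ ∷ p) q = #up-++ p q

#down-++ : ∀ p q → #down (p ++ q) ≡ #down p + #down q
#down-++ [] q = refl
#down-++ (up ∷ p) q = #down-++ p q
#down-++ (down _ ∷ p) q = cong suc (#down-++ p q)

weight-++ : ∀ p q → weight (p ++ q) ≡ weight p + weight q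
weight-++ [] q = refl
weight-++ (up ∷ p) q = weight-++ p q
weight-++ (down w ∷ p) q = trans (cong (w +_) (weight-++ p q)) (sym (+-assoc w _ _))

#up-rotateBy : ∀ k xs → #up (rotateBy k xs) ≡ #up xs
#up-rotateBy = Additive.f-rotateBy #up #up-++

#down-rotateBy : ∀ k xs → #down (rotateBy k xs) ≡ #down xs
#down-rotateBy = Additive.f-rotateBy #down #down-++

weight-rotateBy : ∀ k xs → weight (rotateBy k xs) ≡ weight xs
weight-rotateBy = Additive.f-rotateBy weight weight-++

good : List Letter → ℕ
good xs = 𝟙 (positiveFrom 0 xs)

goodRotations : List Letter → ℕ
goodRotations xs = Σ< (length xs) (λ i → good (rotateBy i xs))

HasExcess : ℕ → List Letter → Set
HasExcess s xs = #up xs ≡ s + weight xs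

HasExcess-rotateBy : ∀ {s} k xs → HasExcess s xs → HasExcess s (rotateBy k xs)
HasExcess-rotateBy {s} k xs e = trans (#up-rotateBy k xs) (trans e (cong (s +_) (sym (weight-rotateBy k xs))))

goodRotations-rotate : ∀ xs → goodRotations (rotate xs) ≡ goodRotations xs
goodRotations-rotate [] = refl
goodRotations-rotate xs@(x ∷ r) = begin
    goodRotations (r ++ [ x ])
      ≡⟨ cong (λ n → Σ< n (λ i → good (rotateBy (suc i) xs))) (length-rotateBy 1 xs) ⟩
    Σ< (length r) (λ i → good (rotateBy (suc i) xs)) + good (rotateBy (length xs) xs)
      ≡⟨ cong (λ z → Σ< (length r) (λ i → good (rotateBy (suc i) xs)) + good z) (rotateBy-length xs) ⟩
    Σ< (length r) (λ i → good (rotateBy (suc i) xs)) + good xs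
      ≡⟨ +-comm _ (good xs) ⟩
    good xs + Σ< (length r) (λ i → good (rotateBy (suc i) xs))
      ≡⟨ Σ<-cons (length r) (λ i → good (rotateBy i xs)) ⟨
    goodRotations xs ∎
  where open ≡-Reasoning

goodRotations-rotateBy : ∀ k xs → goodRotations (rotateBy k xs) ≡ goodRotations xs
goodRotations-rotateBy zero xs = refl
goodRotations-rotateBy (suc k) xs = trans (goodRotations-rotateBy k (rotate xs)) (goodRotations-rotate xs)

goodRotations-++ : ∀ ps ys → goodRotations (ps ++ ys) ≡ Σ< (length ps) (λ i → good (rotateBy i (ps ++ ys)))
                                                      + Σ< (length ys) (λ j → good (rotateBy j (ys ++ ps)))
goodRotations-++ ps ys = begin
    goodRotations (ps ++ ys)
      ≡⟨ cong (λ n → Σ< n (λ i → good (rotateBy i (ps ++ ys)))) (length-++ ps) ⟩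
    Σ< (length ps + length ys) (λ i → good (rotateBy i (ps ++ ys)))
      ≡⟨ Σ<-split (length ps) (length ys) _ ⟩
    Σ< (length ps) (λ i → good (rotateBy i (ps ++ ys))) + Σ< (length ys) (λ j → good (rotateBy (length ps + j) (ps ++ ys)))
      ≡⟨ cong (Σ< (length ps) (λ i → good (rotateBy i (ps ++ ys))) +_) (Σ<-cong (length ys) λ j _ →
           cong good (trans (rotateBy-+ (length ps) j (ps ++ ys)) (cong (rotateBy j) (rotateBy-++ ps ys)))) ⟩
    Σ< (length ps) (λ i → good (rotateBy i (ps ++ ys))) + Σ< (length ys) (λ j → good (rotateBy j (ys ++ ps))) ∎
  where open ≡-Reasoning

splitAtIndex : ∀ {A : Set} (ys : List A) j → j < length ys →
               Σ (List A) λ p → Σ A λ x → Σ (List A) λ q → ys ≡ p ++ x ∷ q × length p ≡ j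
splitAtIndex (y ∷ ys) zero _ = [] , y , ys , refl , refl
splitAtIndex (y ∷ ys) (suc j) (s≤s j<n) with splitAtIndex ys j j<n
... | p , x , q , eq , len = y ∷ p , x , q , cong (y ∷_) eq , cong suc len

module Replacement (B B' : List Letter)
                   (same : ∀ h p → 1 ≤ h → positiveFrom h (B ++ p) ≡ positiveFrom h (B' ++ p)) where

  replace-at : ∀ q h p → 1 ≤ h → positiveFrom h (q ++ B ++ p) ≡ positiveFrom h (q ++ B' ++ p)
  replace-at [] h p 1≤h = same h p 1≤h
  replace-at (up ∷ q) h p _ = replace-at q (suc h) p (s≤s z≤n)
  replace-at (down w ∷ q) h p _ with w <ᵇ h in w<ᵇh
  ... | true = replace-at q (h ∸ w) p (m<n⇒0<n∸m (≡true⇒< {w} {h} w<ᵇh))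
  ... | false = refl

  -- A nonempty prefix moves the block to height ≥ 1 (or fails before reaching it).
  replace-behind : ∀ x q p → positiveFrom 0 ((x ∷ q) ++ B ++ p) ≡ positiveFrom 0 ((x ∷ q) ++ B' ++ p)
  replace-behind up q p = replace-at q 1 p (s≤s z≤n)
  replace-behind (down w) q p = refl

  -- A rotation starting inside ys places the block behind a nonempty prefix.
  rotations-outside : ∀ ys → Σ< (length ys) (λ j → good (rotateBy j (ys ++ B)))
                           ≡ Σ< (length ys) (λ j → good (rotateBy j (ys ++ B')))
  rotations-outside ys = Σ<-cong (length ys) λ j j<n → rotation j j<n
    where
    rotation : ∀ j → j < length ys → good (rotateBy j (ys ++ B)) ≡ good (rotateBy j (ys ++ B'))
    rotation j j<n with splitAtIndex ys j j<n
    ... | p , x , q , refl , refl = cong 𝟙 (begin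
        positiveFrom 0 (rotateBy (length p) ((p ++ x ∷ q) ++ B))   ≡⟨ cong (positiveFrom 0) (rotateBy-factor p x (q ++ B) (++-assoc p (x ∷ q) B)) ⟩
        positiveFrom 0 ((x ∷ q ++ B) ++ p)                          ≡⟨ cong (positiveFrom 0) (++-assoc (x ∷ q) B p) ⟩
        positiveFrom 0 ((x ∷ q) ++ B ++ p)                          ≡⟨ replace-behind x q p ⟩
        positiveFrom 0 ((x ∷ q) ++ B' ++ p)                         ≡⟨ cong (positiveFrom 0) (++-assoc (x ∷ q) B' p) ⟨
        positiveFrom 0 ((x ∷ q ++ B') ++ p)                         ≡⟨ cong (positiveFrom 0) (rotateBy-factor p x (q ++ B') (++-assoc p (x ∷ q) B')) ⟨
        positiveFrom 0 (rotateBy (length p) ((p ++ x ∷ q) ++ B')) ∎)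
      where open ≡-Reasoning

goodRotations-down0 : ∀ ys → goodRotations (down 0 ∷ ys) ≡ goodRotations ys
goodRotations-down0 ys = begin
    goodRotations (down 0 ∷ ys)                            ≡⟨ goodRotations-++ [ down 0 ] ys ⟩
    Σ< (length ys) (λ j → good (rotateBy j (ys ++ [ down 0 ]))) ≡⟨ Replacement.rotations-outside [ down 0 ] [] same ys ⟩
    Σ< (length ys) (λ j → good (rotateBy j (ys ++ [])))    ≡⟨ Σ<-cong (length ys) (λ j _ → cong (λ z → good (rotateBy j z)) (++-identityʳ ys)) ⟩
    goodRotations ys                                       ∎
  where
  open ≡-Reasoning
  same : ∀ h p → 1 ≤ h → positiveFrom h (down 0 ∷ p) ≡ positiveFrom h p
  same (suc h) p _ = refl

goodRotations-peak : ∀ w ys → goodRotations (up ∷ down (suc w) ∷ ys) ≡ goodRotations (down w ∷ ys)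
goodRotations-peak w ys = begin
    goodRotations (up ∷ down (suc w) ∷ ys)                                  ≡⟨ goodRotations-++ (up ∷ down (suc w) ∷ []) ys ⟩
    Σ< (length ys) (λ j → good (rotateBy j (ys ++ up ∷ down (suc w) ∷ []))) ≡⟨ Replacement.rotations-outside _ _ (λ _ _ _ → refl) ys ⟩
    Σ< (length ys) (λ j → good (rotateBy j (ys ++ [ down w ])))             ≡⟨ goodRotations-++ [ down w ] ys ⟨
    goodRotations (down w ∷ ys)                                             ∎
  where open ≡-Reasoning

findUp : ∀ xs → 1 ≤ #up xs → Σ (List Letter) λ p → Σ (List Letter) λ q → xs ≡ p ++ up ∷ q
findUp (up ∷ xs) _ = [] , xs , refl
findUp (down w ∷ xs) 1≤#up with findUp xs 1≤#up
... | p , q , eq = down w ∷ p , q , cong (down w ∷_) eq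

-- The two local configurations that the cycle lemma removes.
data Factor (xs : List Letter) : Set where
  zeroDown : ∀ p q → xs ≡ p ++ down 0 ∷ q → Factor xs
  peak     : ∀ p w q → xs ≡ p ++ up ∷ down (suc w) ∷ q → Factor xs

factor : ∀ r → 1 ≤ #down r → Factor (up ∷ r)
factor (up ∷ r) 1≤#down with factor r 1≤#down
... | zeroDown p q eq = zeroDown (up ∷ p) q (cong (up ∷_) eq)
... | peak p w q eq = peak (up ∷ p) w q (cong (up ∷_) eq)
factor (down zero ∷ r) _ = zeroDown [ up ] r refl
factor (down (suc w) ∷ r) _ = peak [] w r refl

data Redex (xs : List Letter) : Set where
  zeroDown : ∀ k ys → rotateBy k xs ≡ down 0 ∷ ys → Redex xs
  peak     : ∀ k w ys → rotateBy k xs ≡ up ∷ down (suc w) ∷ ys → Redex xs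

redex : ∀ xs → 1 ≤ #up xs → 1 ≤ #down xs → Redex xs
redex xs 1≤#up 1≤#down with findUp xs 1≤#up
... | p , q , xs≡ with factor (q ++ p) (subst (1 ≤_) (trans (sym (#down-rotateBy (length p) xs)) (cong #down front)) 1≤#down)
  where
  front : rotateBy (length p) xs ≡ up ∷ q ++ p
  front = rotateBy-factor p up q xs≡
... | zeroDown p' q' eq = zeroDown (length p + length p') (q' ++ p') (twoRotations eq)
  where
  twoRotations : up ∷ q ++ p ≡ p' ++ down 0 ∷ q' → rotateBy (length p + length p') xs ≡ down 0 ∷ q' ++ p'
  twoRotations eq = trans (rotateBy-+ (length p) (length p') xs)
    (trans (cong (rotateBy (length p')) (rotateBy-factor p up q xs≡)) (rotateBy-factor p' (down 0) q' eq))
... | peak p' w q' eq = peak (length p + length p') w (q' ++ p') (twoRotations eq)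
  where
  twoRotations : up ∷ q ++ p ≡ p' ++ up ∷ down (suc w) ∷ q' → rotateBy (length p + length p') xs ≡ up ∷ down (suc w) ∷ q' ++ p'
  twoRotations eq = trans (rotateBy-+ (length p) (length p') xs)
    (trans (cong (rotateBy (length p')) (rotateBy-factor p up q xs≡)) (rotateBy-factor p' up (down (suc w) ∷ q') eq))

shrink : ∀ xs → 1 ≤ #up xs → 1 ≤ #down xs →
         Σ (List Letter) λ ys → suc (length ys) ≡ length xs × goodRotations ys ≡ goodRotations xs
                                × (∀ {s} → HasExcess s xs → HasExcess s ys)
shrink xs 1≤#up 1≤#down with redex xs 1≤#up 1≤#down
... | zeroDown k ys eq = ys , len , count , excess
  where
  len : suc (length ys) ≡ length xs
  len = trans (cong length (sym eq)) (length-rotateBy k xs)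
  count : goodRotations ys ≡ goodRotations xs
  count = trans (sym (goodRotations-down0 ys)) (trans (cong goodRotations (sym eq)) (goodRotations-rotateBy k xs))
  excess : ∀ {s} → HasExcess s xs → HasExcess s ys
  excess e = subst (HasExcess _) eq (HasExcess-rotateBy k xs e)
... | peak k w ys eq = down w ∷ ys , len , count , excess
  where
  len : suc (length (down w ∷ ys)) ≡ length xs
  len = trans (cong length (sym eq)) (length-rotateBy k xs)
  count : goodRotations (down w ∷ ys) ≡ goodRotations xs
  count = trans (sym (goodRotations-peak w ys)) (trans (cong goodRotations (sym eq)) (goodRotations-rotateBy k xs))
  excess : ∀ {s} → HasExcess s xs → HasExcess s (down w ∷ ys)
  excess {s} e = suc-injective (trans (subst (HasExcess s) eq (HasExcess-rotateBy k xs e)) (+-suc s _))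

upOnly-good : ∀ xs h → #down xs ≡ 0 → positiveFrom h xs ≡ true
upOnly-good [] h _ = refl
upOnly-good (up ∷ xs) h no-down = upOnly-good xs (suc h) no-down

upOnly-length : ∀ xs → #down xs ≡ 0 → length xs ≡ #up xs
upOnly-length [] _ = refl
upOnly-length (up ∷ xs) no-down = cong suc (upOnly-length xs no-down)

upOnly-weight : ∀ xs → #down xs ≡ 0 → weight xs ≡ 0
upOnly-weight [] _ = refl
upOnly-weight (up ∷ xs) no-down = upOnly-weight xs no-down

cycleLemma : ∀ {s} xs → HasExcess s xs → 1 ≤ s → goodRotations xs ≡ s
cycleLemma xs = byLength (length xs) xs refl
  where
  byLength : ∀ {s} n xs → length xs ≡ n → HasExcess s xs → 1 ≤ s → goodRotations xs ≡ s
  byLength {s} zero [] _ e 1≤s = ⊥-elim (<⇒≱ 1≤s (≤-reflexive (trans (sym (+-identityʳ s)) (sym e))))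
  byLength {s} (suc n) xs len e 1≤s with #down xs in no-down
  ... | zero = begin
      goodRotations xs          ≡⟨ Σ<-cong (length xs) (λ i _ → cong 𝟙 (upOnly-good (rotateBy i xs) 0 (trans (#down-rotateBy i xs) no-down))) ⟩
      Σ< (length xs) (λ _ → 1)  ≡⟨ trans (Σ<-const (length xs) 1) (*-identityʳ _) ⟩
      length xs                 ≡⟨ upOnly-length xs no-down ⟩
      #up xs                    ≡⟨ e ⟩
      s + weight xs             ≡⟨ cong (s +_) (upOnly-weight xs no-down) ⟩
      s + 0                     ≡⟨ +-identityʳ s ⟩
      s                         ∎
    where open ≡-Reasoning
  ... | suc _ with shrink xs 1≤#up (subst (1 ≤_) (sym no-down) (s≤s z≤n))
    where
    1≤#up : 1 ≤ #up xs
    1≤#up = subst (1 ≤_) (sym e) (≤-trans 1≤s (m≤m+n s _))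
  ... | ys , len' , count , excess =
      trans (sym count) (byLength n ys (suc-injective (trans len' len)) (excess e) 1≤s)

∸-+-shift : ∀ {h u} x y → u ≤ h → h ∸ u + x ∸ y ≡ h + x ∸ (u + y)
∸-+-shift {h} {u} x y u≤h = trans (cong (_∸ y) (sym (+-∸-comm {h} x u≤h))) (∸-+-assoc (h + x) u y)

positive-prefix : ∀ h xs ys → positiveFrom h (xs ++ ys) ≡ true → positiveFrom h xs ≡ true
positive-prefix h [] ys _ = refl
positive-prefix h (up ∷ xs) ys pos = positive-prefix (suc h) xs ys pos
positive-prefix h (down w ∷ xs) ys pos =
  cong₂ _∧_ (∧-conicalˡ _ _ pos) (positive-prefix (h ∸ w) xs ys (∧-conicalʳ _ _ pos))

positive-++ : ∀ h xs ys → positiveFrom h xs ≡ true →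
              positiveFrom h (xs ++ ys) ≡ positiveFrom (h + #up xs ∸ weight xs) ys
positive-++ h [] ys _ = cong (λ z → positiveFrom z ys) (sym (+-identityʳ h))
positive-++ h (up ∷ xs) ys pos =
  trans (positive-++ (suc h) xs ys pos) (cong (λ z → positiveFrom (z ∸ weight xs) ys) (sym (+-suc h (#up xs))))
positive-++ h (down w ∷ xs) ys pos =
  trans (cong (_∧ positiveFrom (h ∸ w) (xs ++ ys)) (∧-conicalˡ _ _ pos))
    (trans (positive-++ (h ∸ w) xs ys (∧-conicalʳ _ _ pos)) (cong (λ z → positiveFrom z ys) height))
  where
  height : h ∸ w + #up xs ∸ weight xs ≡ h + #up xs ∸ (w + weight xs)
  height = ∸-+-shift {h} {w} (#up xs) (weight xs) (<⇒≤ (≡true⇒< (∧-conicalˡ (w <ᵇ h) _ pos)))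

positive⇒weight< : ∀ h xs → 1 ≤ h → positiveFrom h xs ≡ true → weight xs < h + #up xs
positive⇒weight< h [] 1≤h _ = subst (0 <_) (sym (+-identityʳ h)) 1≤h
positive⇒weight< h (up ∷ xs) _ pos =
  subst (weight xs <_) (sym (+-suc h (#up xs))) (positive⇒weight< (suc h) xs (s≤s z≤n) pos)
positive⇒weight< h (down w ∷ xs) _ pos = begin-strict
    w + weight xs          <⟨ +-monoʳ-< w (positive⇒weight< (h ∸ w) xs (m<n⇒0<n∸m w<h) (∧-conicalʳ _ _ pos)) ⟩
    w + ((h ∸ w) + #up xs) ≡⟨ +-assoc w (h ∸ w) (#up xs) ⟨
    (w + (h ∸ w)) + #up xs ≡⟨ cong (_+ #up xs) (m+[n∸m]≡n (<⇒≤ w<h)) ⟩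
    h + #up xs             ∎
  where
  open ≤-Reasoning
  w<h : w < h
  w<h = ≡true⇒< (∧-conicalˡ (w <ᵇ h) _ pos)

good⇒weight< : ∀ xs → 1 ≤ length xs → positiveFrom 0 xs ≡ true → weight xs < #up xs
good⇒weight< (up ∷ xs) _ pos = positive⇒weight< 1 xs (s≤s z≤n) pos
good⇒weight< (down w ∷ xs) _ ()

-- Labelled path words: E becomes an up-step and the successive N-steps become down-steps of
-- weights u, v, u, v, … ; the total down-weight of the first y N-steps is g u v y.

label : ℕ → ℕ → List Step → List Letter
label u v [] = []
label u v (E ∷ w) = up ∷ label u v w
label u v (N ∷ w) = down u ∷ label v u w

#E : List Step → ℕ
#E [] = 0
#E (E ∷ w) = suc (#E w)
#E (N ∷ w) = #E w

#N : List Step → ℕ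
#N [] = 0
#N (E ∷ w) = #N w
#N (N ∷ w) = suc (#N w)

-- alternate k u v is the weight of the (k+1)-st N-step: u for even k, v for odd k.
alternate : ℕ → ℕ → ℕ → ℕ
alternate zero u v = u
alternate (suc k) u v = alternate k v u

alternate-+ : ∀ k k' u v → alternate (k + k') u v ≡ alternate k' (alternate k u v) (alternate k v u)
alternate-+ zero k' u v = refl
alternate-+ (suc k) k' u v = alternate-+ k k' v u

-- Parity of a number of N-steps, expressed through the weight order it leads to.
Even Odd : ℕ → Set
Even k = ∀ u v → alternate k u v ≡ u
Odd k = ∀ u v → alternate k u v ≡ v

length-#E+#N : ∀ w → length w ≡ #E w + #N w
length-#E+#N [] = refl
length-#E+#N (E ∷ w) = cong suc (length-#E+#N w)
length-#E+#N (N ∷ w) = trans (cong suc (length-#E+#N w)) (sym (+-suc (#E w) (#N w)))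

#E-++ : ∀ p q → #E (p ++ q) ≡ #E p + #E q
#E-++ [] q = refl
#E-++ (E ∷ p) q = cong suc (#E-++ p q)
#E-++ (N ∷ p) q = #E-++ p q

#N-++ : ∀ p q → #N (p ++ q) ≡ #N p + #N q
#N-++ [] q = refl
#N-++ (E ∷ p) q = #N-++ p q
#N-++ (N ∷ p) q = cong suc (#N-++ p q)

#E-rotateBy : ∀ k w → #E (rotateBy k w) ≡ #E w
#E-rotateBy = Additive.f-rotateBy #E #E-++

#N-rotateBy : ∀ k w → #N (rotateBy k w) ≡ #N w
#N-rotateBy = Additive.f-rotateBy #N #N-++

#E-from-length : ∀ w {L k} → length w ≡ L + k → #N w ≡ k → #E w ≡ L
#E-from-length w {L} {k} len #N≡ = +-cancelʳ-≡ k (#E w) L (trans (cong (#E w +_) (sym #N≡)) (trans (sym (length-#E+#N w)) len))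

#up-label : ∀ u v w → #up (label u v w) ≡ #E w
#up-label u v [] = refl
#up-label u v (E ∷ w) = cong suc (#up-label u v w)
#up-label u v (N ∷ w) = #up-label v u w

#down-label : ∀ u v w → #down (label u v w) ≡ #N w
#down-label u v [] = refl
#down-label u v (E ∷ w) = #down-label u v w
#down-label u v (N ∷ w) = cong suc (#down-label v u w)

weight-label : ∀ u v w → weight (label u v w) ≡ g u v (#N w)
weight-label u v [] = refl
weight-label u v (E ∷ w) = weight-label u v w
weight-label u v (N ∷ w) = cong (u +_) (weight-label v u w)

length-label : ∀ u v w → length (label u v w) ≡ length w
length-label u v [] = refl
length-label u v (E ∷ w) = cong suc (length-label u v w)
length-label u v (N ∷ w) = cong suc (length-label v u w)

label-++ : ∀ u v p q → label u v (p ++ q) ≡ label u v p ++ label (alternate (#N p) u v) (alternate (#N p) v u) q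
label-++ u v [] q = refl
label-++ u v (E ∷ p) q = cong (up ∷_) (label-++ u v p q)
label-++ u v (N ∷ p) q = cong (down u ∷_) (label-++ v u p q)

goodRotations-label : ∀ u v s w → #E w ≡ s + g u v (#N w) → 1 ≤ s → goodRotations (label u v w) ≡ s
goodRotations-label u v s w excess 1≤s = cycleLemma (label u v w)
  (trans (#up-label u v w) (trans excess (cong (s +_) (sym (weight-label u v w))))) 1≤s

label-pair-rotate : ∀ a b (f : List Letter → ℕ) w → Even (#N w) →
  f (label a b (rotate w)) + f (label b a (rotate w)) ≡ f (rotate (label a b w)) + f (rotate (label b a w))
label-pair-rotate a b f [] _ = refl
label-pair-rotate a b f (E ∷ w) _ = cong₂ (λ x y → f x + f y) (label-++ a b w [ E ]) (label-++ b a w [ E ])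
label-pair-rotate a b f (N ∷ w) even =
  trans (cong₂ (λ x y → f x + f y) (lastN a b) (lastN b a)) (+-comm (f (label a b w ++ [ down b ])) _)
  where
  lastN : ∀ u v → label u v (w ++ [ N ]) ≡ label u v w ++ [ down v ]
  lastN u v = trans (label-++ u v w [ N ]) (cong (λ z → label u v w ++ [ down z ]) (even v u))

label-pair-rotateBy : ∀ a b (f : List Letter → ℕ) i w → Even (#N w) →
  f (label a b (rotateBy i w)) + f (label b a (rotateBy i w)) ≡ f (rotateBy i (label a b w)) + f (rotateBy i (label b a w))
label-pair-rotateBy a b f zero w _ = refl
label-pair-rotateBy a b f (suc i) w even =
  trans (label-pair-rotateBy a b f i (rotate w) (λ u v → trans (cong (λ k → alternate k u v) (#N-rotateBy 1 w)) (even u v)))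
        (label-pair-rotate a b (λ x → f (rotateBy i x)) w even)

rotations-even : ∀ a b s w → Even (#N w) → #E w ≡ s + g a b (#N w) → #E w ≡ s + g b a (#N w) → 1 ≤ s →
  Σ< (length w) (λ i → good (label a b (rotateBy i w)) + good (label b a (rotateBy i w))) ≡ s + s
rotations-even a b s w even excess-ab excess-ba 1≤s = begin
    Σ< (length w) (λ i → good (label a b (rotateBy i w)) + good (label b a (rotateBy i w)))
      ≡⟨ Σ<-cong (length w) (λ i _ → label-pair-rotateBy a b good i w even) ⟩
    Σ< (length w) (λ i → good (rotateBy i (label a b w)) + good (rotateBy i (label b a w)))
      ≡⟨ Σ<-+ (length w) _ _ ⟩
    Σ< (length w) (λ i → good (rotateBy i (label a b w))) + Σ< (length w) (λ i → good (rotateBy i (label b a w)))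
      ≡⟨ cong₂ (λ m n → Σ< m (λ i → good (rotateBy i (label a b w))) + Σ< n (λ i → good (rotateBy i (label b a w))))
               (sym (length-label a b w)) (sym (length-label b a w)) ⟩
    goodRotations (label a b w) + goodRotations (label b a w)
      ≡⟨ cong₂ _+_ (goodRotations-label a b s w excess-ab 1≤s) (goodRotations-label b a s w excess-ba 1≤s) ⟩
    s + s ∎
  where open ≡-Reasoning

-- Comparison of the two labellings for weights a ≤ b = a + d: the labelling by b, a is d lower
-- than the one by a, b after an even number of N-steps and at least as high after an odd number.
module Comparison (a d : ℕ) where

  b : ℕ
  b = a + d

  dominate-ab : ∀ w h h' → h + d ≤ h' → positiveFrom h (label a b w) ≡ true → positiveFrom h' (label b a w) ≡ true
  dominate-ba : ∀ w h h' → h ≤ h' → positiveFrom h (label b a w) ≡ true → positiveFrom h' (label a b w) ≡ true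
  dominate-ab [] h h' _ _ = refl
  dominate-ab (E ∷ w) h h' h+d≤h' pos = dominate-ab w (suc h) (suc h') (s≤s h+d≤h') pos
  dominate-ab (N ∷ w) h h' h+d≤h' pos =
    cong₂ _∧_ (<ᵇ⇒≡true b<h') (dominate-ba w (h ∸ a) (h' ∸ b) heights (∧-conicalʳ (a <ᵇ h) _ pos))
    where
    a<h : a < h
    a<h = ≡true⇒< (∧-conicalˡ (a <ᵇ h) _ pos)
    b<h' : b < h'
    b<h' = <-≤-trans (+-monoˡ-< d a<h) h+d≤h'
    heights : h ∸ a ≤ h' ∸ b
    heights = begin
      h ∸ a             ≡⟨ [m+n]∸[m+o]≡n∸o d h a ⟨
      (d + h) ∸ (d + a) ≡⟨ cong₂ _∸_ (+-comm d h) (+-comm d a) ⟩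
      (h + d) ∸ b       ≤⟨ ∸-monoˡ-≤ b h+d≤h' ⟩
      h' ∸ b            ∎
      where open ≤-Reasoning
  dominate-ba [] h h' _ _ = refl
  dominate-ba (E ∷ w) h h' h≤h' pos = dominate-ba w (suc h) (suc h') (s≤s h≤h') pos
  dominate-ba (N ∷ w) h h' h≤h' pos =
    cong₂ _∧_ (<ᵇ⇒≡true a<h') (dominate-ab w (h ∸ b) (h' ∸ a) heights (∧-conicalʳ (b <ᵇ h) _ pos))
    where
    b<h : b < h
    b<h = ≡true⇒< (∧-conicalˡ (b <ᵇ h) _ pos)
    a<h' : a < h'
    a<h' = <-≤-trans (≤-<-trans (m≤m+n a d) b<h) h≤h'
    heights : h ∸ b + d ≤ h' ∸ a
    heights = begin
      h ∸ b + d     ≡⟨ cong (_+ d) (∸-+-assoc h a d) ⟨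
      h ∸ a ∸ d + d ≡⟨ m∸n+n≡m (subst (_≤ h ∸ a) (m+n∸m≡n a d) (∸-monoˡ-≤ a (<⇒≤ b<h))) ⟩
      h ∸ a         ≤⟨ ∸-monoˡ-≤ a h≤h' ⟩
      h' ∸ a        ∎
      where open ≤-Reasoning

-- Doubling: a word w with an odd number of N-steps is turned into w ++ w, which has an even number,
-- so that rotations-even applies; the labelling by b, a of w ++ w is never good, and the labelling
-- by a, b of w ++ w is good exactly when that of w is.
module Doubling (a d : ℕ) where
  open Comparison a d

  label-double : ∀ u v w → Odd (#N w) → label u v (w ++ w) ≡ label u v w ++ label v u w
  label-double u v w odd = trans (label-++ u v w w) (cong₂ (λ x y → label u v w ++ label x y w) (odd u v) (odd v u))

  -- If the labelling by a, b of w is good, it ends at height s ≥ d, from where the labelling by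
  -- b, a of the second copy stays positive (dominate-ab); conversely a good labelling of w ++ w
  -- has a good prefix.
  good-double-ab : ∀ s w → d ≤ s → Odd (#N w) → #E w ≡ s + g a b (#N w) → good (label a b (w ++ w)) ≡ good (label a b w)
  good-double-ab s w d≤s odd excess with positiveFrom 0 (label a b w) in pos
  ... | true = cong 𝟙 (begin
      positiveFrom 0 (label a b (w ++ w))               ≡⟨ cong (positiveFrom 0) (label-double a b w odd) ⟩
      positiveFrom 0 (label a b w ++ label b a w)        ≡⟨ positive-++ 0 (label a b w) (label b a w) pos ⟩
      positiveFrom (#up (label a b w) ∸ weight (label a b w)) (label b a w)
        ≡⟨ cong (λ z → positiveFrom z (label b a w)) height ⟩
      positiveFrom s (label b a w)                       ≡⟨ dominate-ab w 0 s d≤s pos ⟩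
      true                                               ∎)
    where
    open ≡-Reasoning
    height : #up (label a b w) ∸ weight (label a b w) ≡ s
    height = trans (cong₂ _∸_ (trans (#up-label a b w) excess) (weight-label a b w)) (m+n∸n≡m s (g a b (#N w)))
  ... | false with positiveFrom 0 (label a b (w ++ w)) in pos-double
  ...   | false = refl
  ...   | true with () ← trans (sym pos)
          (positive-prefix 0 (label a b w) (label b a w) (trans (cong (positiveFrom 0) (sym (label-double a b w odd))) pos-double))

  -- The labelling by b, a of w ends at height 0, so no labelling of w ++ w beginning with it is good.
  good-double-ba : ∀ w → Odd (#N w) → #E w ≡ g b a (#N w) → good (label b a (w ++ w)) ≡ 0
  good-double-ba w odd excess with positiveFrom 0 (label b a (w ++ w)) in pos-double
  ... | false = refl
  ... | true = ⊥-elim (<-irrefl weight≡#up (good⇒weight< (label b a w) nonempty pos))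
    where
    pos : positiveFrom 0 (label b a w) ≡ true
    pos = positive-prefix 0 (label b a w) (label a b w) (trans (cong (positiveFrom 0) (sym (label-double b a w odd))) pos-double)
    weight≡#up : weight (label b a w) ≡ #up (label b a w)
    weight≡#up = trans (weight-label b a w) (trans (sym excess) (sym (#up-label b a w)))
    nonempty : 1 ≤ length (label b a w)
    nonempty = atLeastOne (label b a w) (subst (1 ≤_) (sym (#down-label b a w)) (oddPositive (#N w) odd))
      where
      oddPositive : ∀ k → Odd k → 1 ≤ k
      oddPositive zero odd with () ← odd 0 1
      oddPositive (suc k) _ = s≤s z≤n
      atLeastOne : ∀ xs → 1 ≤ #down xs → 1 ≤ length xs
      atLeastOne (_ ∷ _) _ = s≤s z≤n

  rotateBy-double : ∀ {A : Set} i (w : List A) → rotateBy i (w ++ w) ≡ rotateBy i w ++ rotateBy i w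
  rotateBy-double zero w = refl
  rotateBy-double (suc i) [] = rotateBy-double i []
  rotateBy-double (suc i) (x ∷ w) = trans (cong (rotateBy i) double) (rotateBy-double i (w ++ [ x ]))
    where
    double : (w ++ x ∷ w) ++ [ x ] ≡ (w ++ [ x ]) ++ (w ++ [ x ])
    double = trans (++-assoc w (x ∷ w) [ x ]) (sym (++-assoc w [ x ] (w ++ [ x ])))

  good-double : ∀ w → Odd (#N w) → #E w ≡ d + g a b (#N w) → #E w ≡ g b a (#N w) →
                good (label a b (w ++ w)) + good (label b a (w ++ w)) ≡ good (label a b w)
  good-double w odd excess-ab excess-ba =
    trans (cong₂ _+_ (good-double-ab d w ≤-refl odd excess-ab) (good-double-ba w odd excess-ba)) (+-identityʳ _)

  odd-rotateBy : ∀ i w → Odd (#N w) → Odd (#N (rotateBy i w))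
  odd-rotateBy i w odd u v = trans (cong (λ k → alternate k u v) (#N-rotateBy i w)) (odd u v)

  excess-rotateBy : ∀ i w s u v → #E w ≡ s + g u v (#N w) → #E (rotateBy i w) ≡ s + g u v (#N (rotateBy i w))
  excess-rotateBy i w s u v excess = trans (#E-rotateBy i w) (trans excess (cong (λ k → s + g u v k) (sym (#N-rotateBy i w))))

  even-double : ∀ w → Odd (#N w) → Even (#N (w ++ w))
  even-double w odd u v = trans (cong (λ k → alternate k u v) (#N-++ w w))
    (trans (alternate-+ (#N w) (#N w) u v) (trans (cong₂ (alternate (#N w)) (odd u v) (odd v u)) (odd v u)))

  g-double : ∀ u v w → Odd (#N w) → g u v (#N (w ++ w)) ≡ g u v (#N w) + g v u (#N w)
  g-double u v w odd = trans (sym (weight-label u v (w ++ w))) (trans (cong weight (label-double u v w odd))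
    (trans (weight-++ (label u v w) (label v u w)) (cong₂ _+_ (weight-label u v w) (weight-label v u w))))

  -- For an odd number of N-steps with excess d under the labelling by a, b (hence 0 under the
  -- labelling by b, a), exactly d rotations of w have a good labelling by a, b: twice their number
  -- is the number 2d of good labellings of rotations of w ++ w.
  rotations-odd : ∀ w → Odd (#N w) → #E w ≡ d + g a b (#N w) → #E w ≡ g b a (#N w) → 1 ≤ d →
                  Σ< (length w) (λ i → good (label a b (rotateBy i w))) ≡ d
  rotations-odd w odd excess-ab excess-ba 1≤d = *-cancelˡ-≡ _ _ 2 (begin
      2 * Σ< n G                         ≡⟨ cong (Σ< n G +_) (+-identityʳ _) ⟩
      Σ< n G + Σ< n G                    ≡⟨ Σ<-periodic n G (λ j → cong (λ z → good (label a b z))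
                                              (trans (rotateBy-+ n j w) (cong (rotateBy j) (rotateBy-length w)))) ⟨
      Σ< (n + n) G                       ≡⟨ cong (λ k → Σ< k G) (sym (length-++ w)) ⟩
      Σ< (length (w ++ w)) G             ≡⟨ Σ<-cong (length (w ++ w)) (λ i _ → doubled i) ⟨
      Σ< (length (w ++ w)) (λ i → good (label a b (rotateBy i (w ++ w))) + good (label b a (rotateBy i (w ++ w))))
                                         ≡⟨ rotations-even a b d (w ++ w) (even-double w odd) excess2-ab excess2-ba 1≤d ⟩
      d + d                              ≡⟨ cong (d +_) (+-identityʳ d) ⟨
      2 * d                              ∎)
    where
    open ≡-Reasoning
    n = length w
    G : ℕ → ℕ
    G i = good (label a b (rotateBy i w))
    doubled : ∀ i → good (label a b (rotateBy i (w ++ w))) + good (label b a (rotateBy i (w ++ w))) ≡ G i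
    doubled i = trans (cong (λ x → good (label a b x) + good (label b a x)) (rotateBy-double i w))
      (good-double (rotateBy i w) (odd-rotateBy i w odd) (excess-rotateBy i w d a b excess-ab) (excess-rotateBy i w 0 b a excess-ba))
    excess2 : #E (w ++ w) ≡ d + (g a b (#N w) + g b a (#N w))
    excess2 = trans (#E-++ w w) (trans (cong₂ _+_ excess-ab excess-ba) (+-assoc d _ _))
    excess2-ab : #E (w ++ w) ≡ d + g a b (#N (w ++ w))
    excess2-ab = trans excess2 (cong (d +_) (sym (g-double a b w odd)))
    excess2-ba : #E (w ++ w) ≡ d + g b a (#N (w ++ w))
    excess2-ba = trans excess2 (cong (d +_) (trans (+-comm (g a b (#N w)) _) (sym (g-double b a w odd))))

Σw : ℕ → (List Step → ℕ) → ℕ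
Σw zero h = h []
Σw (suc ℓ) h = Σw ℓ (λ w → h (E ∷ w)) + Σw ℓ (λ w → h (N ∷ w))

Σw-cong : ∀ ℓ {h h'} → (∀ w → length w ≡ ℓ → h w ≡ h' w) → Σw ℓ h ≡ Σw ℓ h'
Σw-cong zero eq = eq [] refl
Σw-cong (suc ℓ) eq = cong₂ _+_ (Σw-cong ℓ λ w l → eq (E ∷ w) (cong suc l)) (Σw-cong ℓ λ w l → eq (N ∷ w) (cong suc l))

Σw-+ : ∀ ℓ h h' → Σw ℓ (λ w → h w + h' w) ≡ Σw ℓ h + Σw ℓ h'
Σw-+ zero h h' = refl
Σw-+ (suc ℓ) h h' = trans (cong₂ _+_ (Σw-+ ℓ (λ w → h (E ∷ w)) (λ w → h' (E ∷ w))) (Σw-+ ℓ (λ w → h (N ∷ w)) (λ w → h' (N ∷ w))))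
  (+-interchange (Σw ℓ (λ w → h (E ∷ w))) (Σw ℓ (λ w → h' (E ∷ w))) (Σw ℓ (λ w → h (N ∷ w))) (Σw ℓ (λ w → h' (N ∷ w))))

Σw-* : ∀ ℓ c h → Σw ℓ (λ w → c * h w) ≡ c * Σw ℓ h
Σw-* zero c h = refl
Σw-* (suc ℓ) c h = trans (cong₂ _+_ (Σw-* ℓ c (λ w → h (E ∷ w))) (Σw-* ℓ c (λ w → h (N ∷ w))))
  (sym (*-distribˡ-+ c (Σw ℓ (λ w → h (E ∷ w))) (Σw ℓ (λ w → h (N ∷ w)))))

Σw-0 : ∀ ℓ → Σw ℓ (λ _ → 0) ≡ 0
Σw-0 zero = refl
Σw-0 (suc ℓ) = cong₂ _+_ (Σw-0 ℓ) (Σw-0 ℓ)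

Σw-Σ< : ∀ ℓ k (H : ℕ → List Step → ℕ) → Σw ℓ (λ w → Σ< k (λ i → H i w)) ≡ Σ< k (λ i → Σw ℓ (H i))
Σw-Σ< ℓ zero H = Σw-0 ℓ
Σw-Σ< ℓ (suc k) H = trans (Σw-+ ℓ (λ w → Σ< k (λ i → H i w)) (H k)) (cong (_+ Σw ℓ (H k)) (Σw-Σ< ℓ k H))

-- Words can equally be enumerated by their last letter, so the sum is invariant under rotation.
Σw-snoc : ∀ ℓ h → Σw (suc ℓ) h ≡ Σw ℓ (λ w → h (w ++ [ E ])) + Σw ℓ (λ w → h (w ++ [ N ]))
Σw-snoc zero h = refl
Σw-snoc (suc ℓ) h = trans (cong₂ _+_ (Σw-snoc ℓ (λ w → h (E ∷ w))) (Σw-snoc ℓ (λ w → h (N ∷ w))))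
  (+-interchange (Σw ℓ (λ w → h (E ∷ w ++ [ E ]))) (Σw ℓ (λ w → h (E ∷ w ++ [ N ])))
                 (Σw ℓ (λ w → h (N ∷ w ++ [ E ]))) (Σw ℓ (λ w → h (N ∷ w ++ [ N ]))))

Σw-rotateBy : ∀ k ℓ h → Σw ℓ (λ w → h (rotateBy k w)) ≡ Σw ℓ h
Σw-rotateBy zero ℓ h = refl
Σw-rotateBy (suc k) zero h = Σw-rotateBy k zero h
Σw-rotateBy (suc k) (suc ℓ) h = trans (sym (Σw-snoc ℓ (λ w → h (rotateBy k w)))) (Σw-rotateBy k (suc ℓ) h)

Σw-rotations : ∀ ℓ k f → Σw ℓ (λ w → Σ< k (λ i → f (rotateBy i w))) ≡ k * Σw ℓ f
Σw-rotations ℓ k f = trans (Σw-Σ< ℓ k (λ i w → f (rotateBy i w)))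
  (trans (Σ<-cong k (λ i _ → Σw-rotateBy i ℓ f)) (Σ<-const k (Σw ℓ f)))

Σw-product : ∀ j ℓ h₁ h₂ → Σw (j + ℓ) (λ p → h₁ (take j p) * h₂ (drop j p)) ≡ Σw j h₁ * Σw ℓ h₂
Σw-product zero ℓ h₁ h₂ = Σw-* ℓ (h₁ []) h₂
Σw-product (suc j) ℓ h₁ h₂ =
  trans (cong₂ _+_ (Σw-product j ℓ (λ q → h₁ (E ∷ q)) h₂) (Σw-product j ℓ (λ q → h₁ (N ∷ q)) h₂))
        (sym (*-distribʳ-+ (Σw ℓ h₂) (Σw j (λ q → h₁ (E ∷ q))) (Σw j (λ q → h₁ (N ∷ q)))))

bin : ℕ → ℕ → ℕ
bin n zero = 1
bin zero (suc k) = 0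
bin (suc n) (suc k) = bin n k + bin n (suc k)

Σw-#N : ∀ ℓ k → Σw ℓ (λ w → 𝟙 (#N w ≡ᵇ k)) ≡ bin ℓ k
Σw-#N zero zero = refl
Σw-#N zero (suc k) = refl
Σw-#N (suc ℓ) zero = cong₂ _+_ (Σw-#N ℓ zero) (Σw-0 ℓ)
Σw-#N (suc ℓ) (suc k) =
  trans (+-comm (Σw ℓ (λ w → 𝟙 (#N w ≡ᵇ suc k))) _) (cong₂ _+_ (Σw-#N ℓ k) (Σw-#N ℓ (suc k)))

bin≡C : ∀ n k → bin n k ≡ n C k
bin≡C n zero = refl
bin≡C zero (suc k) = refl
bin≡C (suc n) (suc k) = trans (cong₂ _+_ (bin≡C n k) (bin≡C n (suc k))) (nCk+nC[k+1]≡[n+1]C[k+1] n k)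

bin-1 : ∀ n → bin n 1 ≡ n
bin-1 zero = refl
bin-1 (suc n) = cong suc (bin-1 n)

bin-absorb : ∀ n k → suc k * bin (suc n) (suc k) ≡ suc n * bin n k
bin-absorb zero zero = refl
bin-absorb zero (suc k) = *-zeroʳ (suc (suc k))
bin-absorb (suc n) zero = trans (+-identityʳ _) (trans (cong (λ z → suc (suc z)) (bin-1 n)) (sym (*-identityʳ (suc (suc n)))))
bin-absorb (suc n) (suc k) = begin
    suc (suc k) * (X + Z)                 ≡⟨ *-distribˡ-+ (suc (suc k)) X Z ⟩
    suc (suc k) * X + suc (suc k) * Z     ≡⟨ cong (suc (suc k) * X +_) (bin-absorb n (suc k)) ⟩
    suc (suc k) * X + suc n * Y₂          ≡⟨ cong (λ z → X + z + suc n * Y₂) (bin-absorb n k) ⟩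
    (Y₁ + Y₂ + suc n * Y₁) + suc n * Y₂   ≡⟨ regroup n Y₁ Y₂ ⟩
    suc (suc n) * (Y₁ + Y₂)               ∎
  where
  open ≡-Reasoning
  X = bin (suc n) (suc k)
  Z = bin (suc n) (suc (suc k))
  Y₁ = bin n k
  Y₂ = bin n (suc k)
  regroup : ∀ n y₁ y₂ → (y₁ + y₂ + suc n * y₁) + suc n * y₂ ≡ suc (suc n) * (y₁ + y₂)
  regroup = solve-∀

bin-absorb' : ∀ m k L → m + k ≡ L → suc m * bin (suc L) k ≡ suc L * bin L k
bin-absorb' m zero _ refl = trans (*-identityʳ (suc m)) (trans (cong suc (sym (+-identityʳ m))) (sym (*-identityʳ _)))
bin-absorb' m (suc k) _ refl = +-cancelʳ-≡ (suc k * B) _ _ (begin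
    suc m * B + suc k * B                          ≡⟨ *-distribʳ-+ B (suc m) (suc k) ⟨
    suc n * B                                      ≡⟨ *-distribˡ-+ (suc n) (bin n k) (bin n (suc k)) ⟩
    suc n * bin n k + suc n * bin n (suc k)        ≡⟨ cong (_+ suc n * bin n (suc k)) (bin-absorb n k) ⟨
    suc k * B + suc n * bin n (suc k)              ≡⟨ +-comm (suc k * B) _ ⟩
    suc n * bin n (suc k) + suc k * B              ∎)
  where
  open ≡-Reasoning
  n = m + suc k
  B = bin (suc n) (suc k)

Σw-by-rotations : ∀ T k (f : List Step → ℕ) s → (∀ w → length w ≡ T → #N w ≡ k → Σ< T (λ i → f (rotateBy i w)) ≡ s) →
                  T * Σw T (λ w → 𝟙 (#N w ≡ᵇ k) * f w) ≡ s * bin T k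
Σw-by-rotations T k f s rotations = begin
    T * Σw T (λ w → 𝟙 (#N w ≡ᵇ k) * f w)                   ≡⟨ Σw-rotations T T (λ w → 𝟙 (#N w ≡ᵇ k) * f w) ⟨
    Σw T (λ w → Σ< T (λ i → 𝟙 (#N (rotateBy i w) ≡ᵇ k) * f (rotateBy i w)))
      ≡⟨ Σw-cong T (λ w _ → trans (Σ<-cong T (λ i _ → cong (λ z → 𝟙 (z ≡ᵇ k) * f (rotateBy i w)) (#N-rotateBy i w)))
                                  (Σ<-* T (𝟙 (#N w ≡ᵇ k)) (λ i → f (rotateBy i w)))) ⟩
    Σw T (λ w → 𝟙 (#N w ≡ᵇ k) * Σ< T (λ i → f (rotateBy i w))) ≡⟨ Σw-cong T pointwise ⟩
    Σw T (λ w → s * 𝟙 (#N w ≡ᵇ k))                          ≡⟨ Σw-* T s (λ w → 𝟙 (#N w ≡ᵇ k)) ⟩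
    s * Σw T (λ w → 𝟙 (#N w ≡ᵇ k))                          ≡⟨ cong (s *_) (Σw-#N T k) ⟩
    s * bin T k                                             ∎
  where
  open ≡-Reasoning
  pointwise : ∀ w → length w ≡ T → 𝟙 (#N w ≡ᵇ k) * Σ< T (λ i → f (rotateBy i w)) ≡ s * 𝟙 (#N w ≡ᵇ k)
  pointwise w len with #N w ≡ᵇ k in #N≡ᵇ
  ... | false = sym (*-zeroʳ s)
  ... | true = trans (+-identityʳ _) (trans (rotations w len (≡true⇒≡ #N≡ᵇ)) (sym (*-identityʳ s)))

-- A good labelled word starts with an up-step, after which it is positive from height 1.
Σw-good : ∀ u v L k → Σw (suc L) (λ w → 𝟙 (#N w ≡ᵇ k) * good (label u v w))
                    ≡ Σw L (λ p → 𝟙 (#N p ≡ᵇ k) * 𝟙 (positiveFrom 1 (label u v p)))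
Σw-good u v L k = trans (cong (Σw L (λ p → 𝟙 (#N p ≡ᵇ k) * 𝟙 (positiveFrom 1 (label u v p))) +_)
                              (trans (Σw-cong L (λ p _ → *-zeroʳ (𝟙 (#N (N ∷ p) ≡ᵇ k)))) (Σw-0 L)))
                        (+-identityʳ _)

divide-out : ∀ T D X s B B' → suc T * X ≡ s * B → D * B ≡ suc T * B' → D * X ≡ s * B'
divide-out T D X s B B' TX≡sB DB≡TB' = *-cancelˡ-≡ (D * X) (s * B') (suc T) (begin
    suc T * (D * X)   ≡⟨ *-left-comm (suc T) D X ⟩
    D * (suc T * X)   ≡⟨ cong (D *_) TX≡sB ⟩
    D * (s * B)       ≡⟨ *-left-comm D s B ⟩
    s * (D * B)       ≡⟨ cong (s *_) DB≡TB' ⟩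
    s * (suc T * B')  ≡⟨ *-left-comm s (suc T) B' ⟩
    suc T * (s * B')  ∎)
  where open ≡-Reasoning

<ᵇ-∸ : ∀ x y h → (y <ᵇ h ∸ x) ≡ (x + y <ᵇ h)
<ᵇ-∸ zero y h = refl
<ᵇ-∸ (suc x) y zero = refl
<ᵇ-∸ (suc x) y (suc h) = <ᵇ-∸ x y h

<ᵇ-∧-+ : ∀ x y h → ((x <ᵇ h) ∧ (x + y <ᵇ h)) ≡ (x + y <ᵇ h)
<ᵇ-∧-+ zero y zero = refl
<ᵇ-∧-+ zero y (suc h) = refl
<ᵇ-∧-+ (suc x) y zero = refl
<ᵇ-∧-+ (suc x) y (suc h) = <ᵇ-∧-+ x y h

≡ᵇ-refl : ∀ x → (x ≡ᵇ x) ≡ true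
≡ᵇ-refl zero = refl
≡ᵇ-refl (suc x) = ≡ᵇ-refl x

≡ᵇ-+suc : ∀ x y → (x ≡ᵇ x + suc y) ≡ false
≡ᵇ-+suc zero y = refl
≡ᵇ-+suc (suc x) y = ≡ᵇ-+suc x y

≡ᵇ-cancelˡ : ∀ x y z → (x + y ≡ᵇ x + z) ≡ (y ≡ᵇ z)
≡ᵇ-cancelˡ zero y z = refl
≡ᵇ-cancelˡ (suc x) y z = ≡ᵇ-cancelˡ x y z

≤⇒<ᵇ≡false : ∀ {m n} → n ≤ m → (m <ᵇ n) ≡ false
≤⇒<ᵇ≡false {m} {n} n≤m with m <ᵇ n in m<ᵇn
... | false = refl
... | true = ⊥-elim (<⇒≱ (≡true⇒< m<ᵇn) n≤m)

≢⇒≡ᵇ≡false : ∀ {m n} → m ≢ n → (m ≡ᵇ n) ≡ false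
≢⇒≡ᵇ≡false {m} {n} m≢n with m ≡ᵇ n in m≡ᵇn
... | false = refl
... | true = ⊥-elim (m≢n (≡true⇒≡ m≡ᵇn))

𝟙-guard : ∀ (x : Bool) P Q D → (x ≡ true → 𝟙 P ≡ 𝟙 Q + D) → 𝟙 (x ∧ P) ≡ 𝟙 (x ∧ Q) + 𝟙 x * D
𝟙-guard true P Q D eq = trans (eq refl) (cong (𝟙 Q +_) (sym (+-identityʳ D)))
𝟙-guard false P Q D eq = refl

𝟙-∧ : ∀ x y → 𝟙 (x ∧ y) ≡ 𝟙 x * 𝟙 y
𝟙-∧ true true = refl
𝟙-∧ true false = refl
𝟙-∧ false y = refl

𝟙-sum-split : ∀ x y X Y v w → 𝟙 (x + y ≡ᵇ X + Y) * ((𝟙 (x ≡ᵇ X) * v) * w) ≡ (𝟙 (x ≡ᵇ X) * v) * (𝟙 (y ≡ᵇ Y) * w)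
𝟙-sum-split x y X Y v w with x ≡ᵇ X in x≡ᵇX
... | false = *-zeroʳ (𝟙 (x + y ≡ᵇ X + Y))
... | true = trans (cong (λ z → 𝟙 z * ((1 * v) * w)) (trans (cong (λ z → z + y ≡ᵇ X + Y) (≡true⇒≡ {x} {X} x≡ᵇX)) (≡ᵇ-cancelˡ X y Y)))
                   (rearrange (𝟙 (y ≡ᵇ Y)) v w)
  where
  rearrange : ∀ i v w → i * ((1 * v) * w) ≡ (1 * v) * (i * w)
  rearrange = solve-∀

2*suc : ∀ r → 2 * suc r ≡ suc (suc (2 * r))
2*suc = solve-∀

g-odd : ∀ u v r → g u v (suc (2 * r)) ≡ u + r * (v + u)
g-odd u v zero = refl
g-odd u v (suc r) = trans (cong (λ z → g u v (suc z)) (2*suc r))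
  (trans (cong (λ z → u + (v + z)) (g-odd u v r)) (regroup u v r))
  where
  regroup : ∀ u v r → u + (v + (u + r * (v + u))) ≡ u + suc r * (v + u)
  regroup = solve-∀

g-even : ∀ u v r → g u v (2 * r) ≡ r * (u + v)
g-even u v zero = refl
g-even u v (suc r) = trans (cong (g u v) (2*suc r))
  (trans (cong (λ z → u + (v + z)) (g-even u v r)) (regroup u v r))
  where
  regroup : ∀ u v r → u + (v + r * (u + v)) ≡ suc r * (u + v)
  regroup = solve-∀

alternate-even : ∀ r → Even (2 * r)
alternate-even zero u v = refl
alternate-even (suc r) u v = trans (cong (λ z → alternate z u v) (2*suc r)) (alternate-even r u v)

alternate-odd : ∀ r → Odd (suc (2 * r))
alternate-odd r u v = alternate-even r v u

evenOrOdd : ∀ k → (Σ ℕ λ r → k ≡ 2 * r) ⊎ (Σ ℕ λ r → k ≡ suc (2 * r))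
evenOrOdd zero = inj₁ (0 , refl)
evenOrOdd (suc k) with evenOrOdd k
... | inj₁ (r , eq) = inj₂ (r , cong suc eq)
... | inj₂ (r , eq) = inj₁ (suc r , trans (cong suc eq) (sym (2*suc r)))

module Reindex (φ : ℕ → ℕ) (φ-mono : ∀ {r r'} → r < r' → φ r < φ r') where

  φ-mono-≤ : ∀ {r r'} → r ≤ r' → φ r ≤ φ r'
  φ-mono-≤ r≤r' with m≤n⇒m<n∨m≡n r≤r'
  ... | inj₁ r<r' = <⇒≤ (φ-mono r<r')
  ... | inj₂ refl = ≤-refl

  φ-reflect-< : ∀ {r r'} → φ r < φ r' → r < r'
  φ-reflect-< {r} {r'} φr<φr' with r <? r'
  ... | yes r<r' = r<r'
  ... | no r≮r' = ⊥-elim (<⇒≱ φr<φr' (φ-mono-≤ (≮⇒≥ r≮r')))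

  Σ<-reindex : ∀ n L (t : ℕ → ℕ) → (∀ r → r < n → φ r < L) → L ≤ φ n →
               (∀ j → j < L → (∀ r → j ≢ φ r) → t j ≡ 0) → Σ< L t ≡ Σ< n (λ r → t (φ r))
  Σ<-reindex zero L t _ L≤φ0 off = Σ<-zero L λ j j<L → off j j<L λ r j≡φr →
    <⇒≱ (<-≤-trans j<L L≤φ0) (subst (φ 0 ≤_) (sym j≡φr) (φ-mono-≤ z≤n))
  Σ<-reindex (suc n) L t below L≤φ[n+1] off = begin
      Σ< L t                                                       ≡⟨ cong (λ k → Σ< k t) (sym L≡) ⟩
      Σ< (suc (φ n) + (L ∸ suc (φ n))) t                           ≡⟨ Σ<-split (suc (φ n)) (L ∸ suc (φ n)) t ⟩
      Σ< (suc (φ n)) t + Σ< (L ∸ suc (φ n)) (λ i → t (suc (φ n) + i)) ≡⟨ cong (Σ< (suc (φ n)) t +_) (Σ<-zero _ beyond) ⟩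
      Σ< (suc (φ n)) t + 0                                         ≡⟨ +-identityʳ _ ⟩
      Σ< (φ n) t + t (φ n)                                         ≡⟨ cong (_+ t (φ n)) (Σ<-reindex n (φ n) t (λ r → φ-mono) ≤-refl
                                                                         (λ j j<φn → off j (<-trans j<φn φn<L))) ⟩
      Σ< n (λ r → t (φ r)) + t (φ n)                               ∎
    where
    open ≡-Reasoning
    φn<L : φ n < L
    φn<L = below n ≤-refl
    L≡ : suc (φ n) + (L ∸ suc (φ n)) ≡ L
    L≡ = m+[n∸m]≡n φn<L
    beyond : ∀ i → i < L ∸ suc (φ n) → t (suc (φ n) + i) ≡ 0
    beyond i i<L' = off (suc (φ n) + i) j<L λ r j≡φr → <⇒≱ (<-≤-trans j<L L≤φ[n+1])
        (subst (φ (suc n) ≤_) (sym j≡φr) (φ-mono-≤ (φ-reflect-< (subst (φ n <_) j≡φr (s≤s (m≤m+n (φ n) i))))))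
      where
      j<L : suc (φ n) + i < L
      j<L = subst (suc (φ n) + i <_) L≡ (+-monoʳ-< (suc (φ n)) i<L')

WordsWith : (List Step → Bool) → ℕ → Set
WordsWith P ℓ = Σ (List Step) (λ p → T (P p) × length p ≡ ℓ)

wordsWith-[] : ∀ (P : List Step → Bool) → Fin (𝟙 (P [])) ↔ WordsWith P 0
wordsWith-[] P with P [] in P[]
... | true = mk↔ₛ′ (λ _ → [] , subst T (sym P[]) tt , refl) (λ _ → zero) onlyWord onlyIndex
  where
  onlyWord : ∀ y → ([] , subst T (sym P[]) tt , refl) ≡ y
  onlyWord ([] , t , refl) = cong (λ z → [] , z , refl) (T-irrelevant _ _)
  onlyIndex : ∀ (i : Fin 1) → zero ≡ i
  onlyIndex zero = refl
... | false = mk↔ₛ′ (λ ()) noWord (λ y → ⊥-elim (Fin0-empty (noWord y))) (λ ())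
  where
  Fin0-empty : Fin 0 → ⊥
  Fin0-empty ()
  noWord : WordsWith P 0 → Fin 0
  noWord ([] , t , _) = ⊥-elim (subst T P[] t)
  noWord (_ ∷ _ , _ , ())

wordsWith-∷ : ∀ (P : List Step → Bool) ℓ → (WordsWith (λ q → P (E ∷ q)) ℓ ⊎ WordsWith (λ q → P (N ∷ q)) ℓ) ↔ WordsWith P (suc ℓ)
wordsWith-∷ P ℓ = mk↔ₛ′ to from to∘from from∘to
  where
  to : WordsWith (λ q → P (E ∷ q)) ℓ ⊎ WordsWith (λ q → P (N ∷ q)) ℓ → WordsWith P (suc ℓ)
  to (inj₁ (q , t , len)) = E ∷ q , t , cong suc len
  to (inj₂ (q , t , len)) = N ∷ q , t , cong suc len
  from : WordsWith P (suc ℓ) → WordsWith (λ q → P (E ∷ q)) ℓ ⊎ WordsWith (λ q → P (N ∷ q)) ℓ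
  from (E ∷ q , t , len) = inj₁ (q , t , suc-injective len)
  from (N ∷ q , t , len) = inj₂ (q , t , suc-injective len)
  to∘from : ∀ y → to (from y) ≡ y
  to∘from (E ∷ q , t , len) = cong (λ z → E ∷ q , t , z) (≡-irrelevant _ _)
  to∘from (N ∷ q , t , len) = cong (λ z → N ∷ q , t , z) (≡-irrelevant _ _)
  from∘to : ∀ x → from (to x) ≡ x
  from∘to (inj₁ (q , t , len)) = cong (λ z → inj₁ (q , t , z)) (≡-irrelevant _ _)
  from∘to (inj₂ (q , t , len)) = cong (λ z → inj₂ (q , t , z)) (≡-irrelevant _ _)

Σw-enumerates : ∀ ℓ (P : List Step → Bool) → Fin (Σw ℓ (λ p → 𝟙 (P p))) ↔ WordsWith P ℓ
Σw-enumerates zero P = wordsWith-[] P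
Σw-enumerates (suc ℓ) P =
  ↔-trans +↔⊎ (↔-trans (Σw-enumerates ℓ (λ q → P (E ∷ q)) ⊎-↔ Σw-enumerates ℓ (λ q → P (N ∷ q))) (wordsWith-∷ P ℓ))

endpoint≡ : ∀ q → endpoint q ≡ (#E q , #N q)
endpoint≡ [] = refl
endpoint≡ (E ∷ q) rewrite endpoint≡ q = refl
endpoint≡ (N ∷ q) rewrite endpoint≡ q = refl

Under : ℕ → ℕ → ℕ → List Step → Set
Under h u v q = g u v (#N q) ≤ #E q + h

Under-E : ∀ h u v q → Under h u v (E ∷ q) ≡ Under (suc h) u v q
Under-E h u v q = cong (g u v (#N q) ≤_) (sym (+-suc (#E q) h))

Under-N : ∀ h u v q → u ≤ h → Under h u v (N ∷ q) ⇔ Under (h ∸ u) v u q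
Under-N h u v q u≤h = mk⇔ (λ under → +-cancelˡ-≤ u _ _ (subst (u + g v u (#N q) ≤_) shift under))
                         (λ under → subst (u + g v u (#N q) ≤_) (sym shift) (+-monoʳ-≤ u under))
  where
  shift : #E q + h ≡ u + (#E q + (h ∸ u))
  shift = begin
    #E q + h              ≡⟨ cong (#E q +_) (m+[n∸m]≡n u≤h) ⟨
    #E q + (u + (h ∸ u))  ≡⟨ +-assoc (#E q) u (h ∸ u) ⟨
    (#E q + u) + (h ∸ u)  ≡⟨ cong (_+ (h ∸ u)) (+-comm (#E q) u) ⟩
    (u + #E q) + (h ∸ u)  ≡⟨ +-assoc u (#E q) (h ∸ u) ⟩
    u + (#E q + (h ∸ u))  ∎
    where open ≡-Reasoning

UnderAll : ℕ → ℕ → ℕ → List Step → Set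
UnderAll h u v p = All (Under h u v) (inits p)

UnderAll⇒positive : ∀ p h u v → UnderAll h u v p → positiveFrom (suc h) (label u v p) ≡ true
UnderAll⇒positive [] h u v _ = refl
UnderAll⇒positive (E ∷ p) h u v (_ ∷ under) =
  UnderAll⇒positive p (suc h) u v (All.map (λ {q} → subst id (Under-E h u v q)) (map⁻ under))
UnderAll⇒positive (N ∷ p) h u v (_ ∷ under) =
  cong₂ _∧_ (<ᵇ⇒≡true (s≤s u≤h)) (subst (λ z → positiveFrom z (label v u p) ≡ true) (sym (+-∸-assoc 1 u≤h))
    (UnderAll⇒positive p (h ∸ u) v u (All.map (λ {q} → Equivalence.to (Under-N h u v q u≤h)) (map⁻ under))))
  where
  u≤h : u ≤ h
  u≤h = subst (_≤ h) (+-identityʳ u) (All.head (map⁻ under))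

positive⇒UnderAll : ∀ p h u v → positiveFrom (suc h) (label u v p) ≡ true → UnderAll h u v p
positive⇒UnderAll [] h u v _ = z≤n ∷ []
positive⇒UnderAll (E ∷ p) h u v pos =
  z≤n ∷ map⁺ (All.map (λ {q} → subst id (sym (Under-E h u v q))) (positive⇒UnderAll p (suc h) u v pos))
positive⇒UnderAll (N ∷ p) h u v pos =
  z≤n ∷ map⁺ (All.map (λ {q} → Equivalence.from (Under-N h u v q u≤h))
    (positive⇒UnderAll p (h ∸ u) v u (subst (λ z → positiveFrom z (label v u p) ≡ true) (+-∸-assoc 1 u≤h)
      (∧-conicalʳ (u <ᵇ suc h) _ pos))))
  where
  u≤h : u ≤ h
  u≤h = ≤-pred (≡true⇒< (∧-conicalˡ (u <ᵇ suc h) _ pos))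

WeaklyUnder⇔UnderAll : ∀ u v p → WeaklyUnder u v p ⇔ UnderAll 0 u v p
WeaklyUnder⇔UnderAll u v p = mk⇔ (All.map (λ {q} → toUnder q)) (All.map (λ {q} → fromUnder q))
  where
  toUnder : ∀ q → g u v (proj₂ (endpoint q)) ≤ proj₁ (endpoint q) → Under 0 u v q
  toUnder q le = subst (g u v (#N q) ≤_) (sym (+-identityʳ (#E q))) (subst (λ e → g u v (proj₂ e) ≤ proj₁ e) (endpoint≡ q) le)
  fromUnder : ∀ q → Under 0 u v q → g u v (proj₂ (endpoint q)) ≤ proj₁ (endpoint q)
  fromUnder q le = subst (λ e → g u v (proj₂ e) ≤ proj₁ e) (sym (endpoint≡ q)) (subst (g u v (#N q) ≤_) (+-identityʳ (#E q)) le)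

isPathWord : ℕ → ℕ → ℕ → List Step → Bool
isPathWord u v Y p = (#N p ≡ᵇ Y) ∧ positiveFrom 1 (label u v p)

paths↔words : ∀ u v X Y → WordsWith (isPathWord u v Y) (X + Y) ↔ Paths u v X Y
paths↔words u v X Y = mk↔ₛ′ to from to∘from from∘to
  where
  to : WordsWith (isPathWord u v Y) (X + Y) → Paths u v X Y
  to (p , t , len) = p , Equivalence.from (WeaklyUnder⇔UnderAll u v p) (positive⇒UnderAll p 0 u v pos) ,
                     trans (endpoint≡ p) (cong₂ _,_ #E≡ #N≡)
    where
    ok : isPathWord u v Y p ≡ true
    ok = Equivalence.to T-≡ t
    pos : positiveFrom 1 (label u v p) ≡ true
    pos = ∧-conicalʳ (#N p ≡ᵇ Y) _ ok
    #N≡ : #N p ≡ Y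
    #N≡ = ≡true⇒≡ (∧-conicalˡ (#N p ≡ᵇ Y) _ ok)
    #E≡ : #E p ≡ X
    #E≡ = +-cancelʳ-≡ Y (#E p) X (trans (cong (#E p +_) (sym #N≡)) (trans (sym (length-#E+#N p)) len))
  from : Paths u v X Y → WordsWith (isPathWord u v Y) (X + Y)
  from (p , under , end) = p , Equivalence.from T-≡ (cong₂ _∧_ (≡⇒≡true #N≡) (UnderAll⇒positive p 0 u v
                                   (Equivalence.to (WeaklyUnder⇔UnderAll u v p) under))) ,
                           trans (length-#E+#N p) (cong₂ _+_ #E≡ #N≡)
    where
    #N≡ : #N p ≡ Y
    #N≡ = trans (cong proj₂ (sym (endpoint≡ p))) (cong proj₂ end)
    #E≡ : #E p ≡ X
    #E≡ = trans (cong proj₁ (sym (endpoint≡ p))) (cong proj₁ end)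
  to∘from : ∀ y → to (from y) ≡ y
  to∘from (p , under , end) = cong₂ (λ x y → p , x , y) (All.irrelevant ≤-irrelevant _ _)
                                    (Decidable⇒UIP.≡-irrelevant (≡-dec _≟_ _≟_) _ _)
  from∘to : ∀ x → from (to x) ≡ x
  from∘to (p , t , len) = cong₂ (λ x y → p , x , y) (T-irrelevant _ _) (≡-irrelevant _ _)

-- Transferring identities of natural numbers to the rationals.  Rationals are reached through
-- unnormalised fractions: ℕtoℚ x is fromℚᵘ (x / 1) and y ÷ℕ (D + 1) is fromℚᵘ (y / (D + 1)).

fromℚᵘ-+ : ∀ p q → fromℚᵘ p +ℚ fromℚᵘ q ≡ fromℚᵘ (p ℚᵘ.+ q)
fromℚᵘ-+ p q = ℚP.toℚᵘ-injective (ℚᵘP.≃-trans (ℚP.toℚᵘ-homo-+ (fromℚᵘ p) (fromℚᵘ q))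
  (ℚᵘP.≃-trans (ℚᵘP.+-cong (ℚP.toℚᵘ-fromℚᵘ p) (ℚP.toℚᵘ-fromℚᵘ q)) (ℚᵘP.≃-sym (ℚP.toℚᵘ-fromℚᵘ (p ℚᵘ.+ q)))))

fromℚᵘ-* : ∀ p q → fromℚᵘ p *ℚ fromℚᵘ q ≡ fromℚᵘ (p ℚᵘ.* q)
fromℚᵘ-* p q = ℚP.toℚᵘ-injective (ℚᵘP.≃-trans (ℚP.toℚᵘ-homo-* (fromℚᵘ p) (fromℚᵘ q))
  (ℚᵘP.≃-trans (ℚᵘP.*-cong (ℚP.toℚᵘ-fromℚᵘ p) (ℚP.toℚᵘ-fromℚᵘ q)) (ℚᵘP.≃-sym (ℚP.toℚᵘ-fromℚᵘ (p ℚᵘ.* q)))))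

NatNumerator : ℚᵘ → ℕ → Set
NatNumerator p n = ℚᵘ.↥ p ≡ ℤ.+ n

NatNumerator-+ : ∀ p q {n m} → NatNumerator p n → NatNumerator q m →
                 NatNumerator (p ℚᵘ.+ q) (n * ℚᵘ.↧ₙ q + m * ℚᵘ.↧ₙ p)
NatNumerator-+ p@record{} q@record{} {n} {m} ↥p ↥q =
  trans (cong₂ (λ i j → i ℤ.* ℚᵘ.↧ q ℤ.+ j ℤ.* ℚᵘ.↧ p) ↥p ↥q)
        (trans (cong₂ ℤ._+_ (sym (ℤP.pos-* n (ℚᵘ.↧ₙ q))) (sym (ℤP.pos-* m (ℚᵘ.↧ₙ p)))) (sym (ℤP.pos-+ (n * ℚᵘ.↧ₙ q) _)))

NatNumerator-* : ∀ p q {n m} → NatNumerator p n → NatNumerator q m → NatNumerator (p ℚᵘ.* q) (n * m)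
NatNumerator-* record{} record{} {n} {m} ↥p ↥q = trans (cong₂ ℤ._*_ ↥p ↥q) (sym (ℤP.pos-* n m))

≃-from-ℕ : ∀ p q {n m} → NatNumerator p n → NatNumerator q m → n * ℚᵘ.↧ₙ q ≡ m * ℚᵘ.↧ₙ p → fromℚᵘ p ≡ fromℚᵘ q
≃-from-ℕ p q {n} {m} ↥p ↥q cross = ℚP.fromℚᵘ-cong {p} {q} (*≡* (begin
    ℚᵘ.↥ p ℤ.* ℚᵘ.↧ q         ≡⟨ cong (ℤ._* ℚᵘ.↧ q) ↥p ⟩
    ℤ.+ n ℤ.* ℚᵘ.↧ q          ≡⟨ ℤP.pos-* n (ℚᵘ.↧ₙ q) ⟨
    ℤ.+ (n * ℚᵘ.↧ₙ q)         ≡⟨ cong ℤ.+_ cross ⟩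
    ℤ.+ (m * ℚᵘ.↧ₙ p)         ≡⟨ ℤP.pos-* m (ℚᵘ.↧ₙ p) ⟩
    ℤ.+ m ℤ.* ℚᵘ.↧ p          ≡⟨ cong (ℤ._* ℚᵘ.↧ p) ↥q ⟨
    ℚᵘ.↥ q ℤ.* ℚᵘ.↧ p         ∎))
  where open ≡-Reasoning

ℕtoℚ-+ : ∀ x y → ℕtoℚ (x + y) ≡ ℕtoℚ x +ℚ ℕtoℚ y
ℕtoℚ-+ x y = trans (≃-from-ℕ (mkℚᵘ (ℤ.+ (x + y)) 0) (mkℚᵘ (ℤ.+ x) 0 ℚᵘ.+ mkℚᵘ (ℤ.+ y) 0) refl (NatNumerator-+ (mkℚᵘ (ℤ.+ x) 0) (mkℚᵘ (ℤ.+ y) 0) refl refl)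
  (arithmetic x y)) (sym (fromℚᵘ-+ (mkℚᵘ (ℤ.+ x) 0) (mkℚᵘ (ℤ.+ y) 0)))
  where
  arithmetic : ∀ x y → (x + y) * (1 * 1) ≡ (x * 1 + y * 1) * 1
  arithmetic = solve-∀

ℕtoℚ-* : ∀ x y → ℕtoℚ (x * y) ≡ ℕtoℚ x *ℚ ℕtoℚ y
ℕtoℚ-* x y = trans (≃-from-ℕ (mkℚᵘ (ℤ.+ (x * y)) 0) (mkℚᵘ (ℤ.+ x) 0 ℚᵘ.* mkℚᵘ (ℤ.+ y) 0) refl (NatNumerator-* (mkℚᵘ (ℤ.+ x) 0) (mkℚᵘ (ℤ.+ y) 0) refl refl)
  (arithmetic x y)) (sym (fromℚᵘ-* (mkℚᵘ (ℤ.+ x) 0) (mkℚᵘ (ℤ.+ y) 0)))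
  where
  arithmetic : ∀ x y → x * y * (1 * 1) ≡ x * y * 1
  arithmetic = solve-∀

ℕtoℚ-quotient : ∀ x y D w → suc D * x ≡ y * w → ℕtoℚ x ≡ (y ÷ℕ suc D) *ℚ ℕtoℚ w
ℕtoℚ-quotient x y D w eq = trans (≃-from-ℕ (mkℚᵘ (ℤ.+ x) 0) (mkℚᵘ (ℤ.+ y) D ℚᵘ.* mkℚᵘ (ℤ.+ w) 0) refl (NatNumerator-* (mkℚᵘ (ℤ.+ y) D) (mkℚᵘ (ℤ.+ w) 0) refl refl)
  (trans (arithmetic₁ x D) (trans eq (arithmetic₂ y w)))) (sym (fromℚᵘ-* (mkℚᵘ (ℤ.+ y) D) (mkℚᵘ (ℤ.+ w) 0)))
  where
  arithmetic₁ : ∀ x D → x * (suc D * 1) ≡ suc D * x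
  arithmetic₁ = solve-∀
  arithmetic₂ : ∀ y w → y * w ≡ y * w * 1
  arithmetic₂ = solve-∀

ℕtoℚ-quotient-plus-half : ∀ x c y D w → suc D * (2 * x) ≡ 2 * (y * w) + suc D * c → ℕtoℚ x ≡ (y ÷ℕ suc D) *ℚ ℕtoℚ w +ℚ ½ *ℚ ℕtoℚ c
ℕtoℚ-quotient-plus-half x c y D w eq = begin
    ℕtoℚ x                                                ≡⟨ ≃-from-ℕ (nat x) (frac ℚᵘ.* nat w ℚᵘ.+ half ℚᵘ.* nat c) refl
                                                               (NatNumerator-+ (frac ℚᵘ.* nat w) (half ℚᵘ.* nat c)
                                                                 (NatNumerator-* frac (nat w) refl refl) (NatNumerator-* half (nat c) refl refl))
                                                               (trans (arithmetic₁ x D) (trans eq (arithmetic₂ y w c D))) ⟩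
    fromℚᵘ (frac ℚᵘ.* nat w ℚᵘ.+ half ℚᵘ.* nat c)         ≡⟨ fromℚᵘ-+ (frac ℚᵘ.* nat w) (half ℚᵘ.* nat c) ⟨
    fromℚᵘ (frac ℚᵘ.* nat w) +ℚ fromℚᵘ (half ℚᵘ.* nat c)  ≡⟨ cong₂ _+ℚ_ (fromℚᵘ-* frac (nat w)) (fromℚᵘ-* half (nat c)) ⟨
    (y ÷ℕ suc D) *ℚ ℕtoℚ w +ℚ ½ *ℚ ℕtoℚ c                 ∎
  where
  open ≡-Reasoning
  nat : ℕ → ℚᵘ
  nat k = mkℚᵘ (ℤ.+ k) 0
  frac half : ℚᵘ
  frac = mkℚᵘ (ℤ.+ y) D
  half = mkℚᵘ (ℤ.+ 1) 1
  arithmetic₁ : ∀ x D → x * ((suc D * 1) * (1 * (2 * 1))) ≡ suc D * (2 * x)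
  arithmetic₁ = solve-∀
  arithmetic₂ : ∀ y w c D → 2 * (y * w) + suc D * c ≡ ((y * w) * (1 * (2 * 1)) + (1 * c) * (suc D * 1)) * 1
  arithmetic₂ = solve-∀

ℕtoℚ-plus-half-quotient : ∀ x c y D w → suc D * (2 * x + c) ≡ 2 * (y * w) → ℕtoℚ x +ℚ ½ *ℚ ℕtoℚ c ≡ (y ÷ℕ suc D) *ℚ ℕtoℚ w
ℕtoℚ-plus-half-quotient x c y D w eq = begin
    ℕtoℚ x +ℚ ½ *ℚ ℕtoℚ c                  ≡⟨ cong (ℕtoℚ x +ℚ_) (fromℚᵘ-* half (nat c)) ⟩
    ℕtoℚ x +ℚ fromℚᵘ (half ℚᵘ.* nat c)     ≡⟨ fromℚᵘ-+ (nat x) (half ℚᵘ.* nat c) ⟩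
    fromℚᵘ (nat x ℚᵘ.+ half ℚᵘ.* nat c)    ≡⟨ ≃-from-ℕ (nat x ℚᵘ.+ half ℚᵘ.* nat c) (mkℚᵘ (ℤ.+ y) D ℚᵘ.* nat w)
                                                 (NatNumerator-+ (nat x) (half ℚᵘ.* nat c) refl (NatNumerator-* half (nat c) refl refl)) (NatNumerator-* (mkℚᵘ (ℤ.+ y) D) (nat w) refl refl)
                                                 (trans (arithmetic₁ x c D) (trans eq (arithmetic₂ y w))) ⟩
    fromℚᵘ (mkℚᵘ (ℤ.+ y) D ℚᵘ.* nat w)       ≡⟨ fromℚᵘ-* (mkℚᵘ (ℤ.+ y) D) (nat w) ⟨
    (y ÷ℕ suc D) *ℚ ℕtoℚ w                 ∎
  where
  open ≡-Reasoning
  nat : ℕ → ℚᵘ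
  nat k = mkℚᵘ (ℤ.+ k) 0
  half : ℚᵘ
  half = mkℚᵘ (ℤ.+ 1) 1
  arithmetic₁ : ∀ x c D → (x * (2 * 1) + 1 * c * 1) * (suc D * 1) ≡ suc D * (2 * x + c)
  arithmetic₁ = solve-∀
  arithmetic₂ : ∀ y w → 2 * (y * w) ≡ y * w * (1 * (2 * 1))
  arithmetic₂ = solve-∀

ℚ-move : ∀ x c z → x +ℚ c ≡ z → x ≡ z -ℚ c
ℚ-move x c z eq = begin
    x                    ≡⟨ ℚP.+-identityʳ x ⟨
    x +ℚ 0ℚ              ≡⟨ cong (x +ℚ_) (ℚP.+-inverseʳ c) ⟨
    x +ℚ (c -ℚ c)        ≡⟨ ℚP.+-assoc x c (ℚ.- c) ⟨
    (x +ℚ c) -ℚ c        ≡⟨ cong (_-ℚ c) eq ⟩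
    z -ℚ c               ∎
  where open ≡-Reasoning

sumℚ-upTo : ∀ n (F : ℕ → ℚ) (G : ℕ → ℕ) → (∀ i → i < n → F i ≡ ℕtoℚ (G i)) → sumℚ (map F (upTo n)) ≡ ℕtoℚ (Σ< n G)
sumℚ-upTo n F G eq = shifted n id (λ i i<n → eq i i<n)
  where
  shifted : ∀ n (h : ℕ → ℕ) → (∀ i → i < n → F (h i) ≡ ℕtoℚ (G (h i))) → sumℚ (map F (applyUpTo h n)) ≡ ℕtoℚ (Σ< n (λ i → G (h i)))
  shifted zero h _ = refl
  shifted (suc n) h eq' = trans (cong₂ _+ℚ_ (eq' 0 (s≤s z≤n)) (shifted n (λ i → h (suc i)) (λ i i<n → eq' (suc i) (s≤s i<n))))
    (trans (sym (ℕtoℚ-+ (G (h 0)) _)) (cong ℕtoℚ (sym (Σ<-cons n (λ i → G (h i))))))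

Σw-isPathWord : ∀ u v X Y L → X + Y ≡ L →
  Σw (X + Y) (λ p → 𝟙 (isPathWord u v Y p)) ≡ Σw L (λ p → 𝟙 (#N p ≡ᵇ Y) * 𝟙 (positiveFrom 1 (label u v p)))
Σw-isPathWord u v X Y _ refl = Σw-cong (X + Y) (λ p _ → 𝟙-∧ (#N p ≡ᵇ Y) (positiveFrom 1 (label u v p)))

pathCount : ∀ u v X Y L → X + Y ≡ L → ∀ {k q} → Σw L (λ p → 𝟙 (#N p ≡ᵇ Y) * 𝟙 (positiveFrom 1 (label u v p))) ≡ k →
            ℕtoℚ k ≡ q → HasCard (Paths u v X Y) q
pathCount u v X Y L X+Y≡L count value =
  Σw (X + Y) (λ p → 𝟙 (isPathWord u v Y p)) ,
  ↔-trans (Σw-enumerates (X + Y) (isPathWord u v Y)) (paths↔words u v X Y) ,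
  trans (cong ℕtoℚ (trans (Σw-isPathWord u v X Y L X+Y≡L) count)) value

module FixedWeights (a d' : ℕ) where

  d : ℕ
  d = suc d'

  b : ℕ
  b = a + d

  -- Lengths of the words encoding the paths to q_r = (c r + b - 1, 2 r + 1) and p_n = (c n + b - a - 1, 2 n).
  lengthQ lengthP : ℕ → ℕ
  lengthQ r = (a + b + 2) * r + b
  lengthP n = (a + b + 2) * n + d'

  -- Compare the labellings by a, b and by b, a of the same word:
  -- after an odd number of N-steps the latter is d lower.  A violation point of the labelling
  -- by a, b is a height d with next weight b, where the labelling by b, a sits at height 0.
  atViolation : ℕ → ℕ → Bool
  atViolation h u = (h ≡ᵇ d) ∧ (u ≡ᵇ b)

  goodTail : List Step → ℕ
  goodTail q = 𝟙 (positiveFrom 1 (label a b q))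

  -- violations h u v p counts the cuts p = q ++ E ∷ q' where the labelling by u, v of q is
  -- positive from h and ends at a violation point, and q' is a good tail.
  violations : ℕ → ℕ → ℕ → List Step → ℕ
  violations h u v [] = 0
  violations h u v (E ∷ q) = 𝟙 (atViolation h u) * goodTail q + violations (suc h) u v q
  violations h u v (N ∷ q) = 𝟙 (u <ᵇ h) * violations (h ∸ u) v u q

  atViolation-a : ∀ h → atViolation h a ≡ false
  atViolation-a h = trans (cong ((h ≡ᵇ d) ∧_) (≡ᵇ-+suc a d')) (∧-zeroʳ (h ≡ᵇ d))

  -- An up-step for the lowered walk: it either keeps the comparison or crosses a violation point.
  violation-step : ∀ h X → 𝟙 ((d <ᵇ suc h) ∧ positiveFrom (suc h ∸ d) X)
                         ≡ 𝟙 ((d <ᵇ h) ∧ positiveFrom (suc (h ∸ d)) X) + 𝟙 (atViolation h b) * 𝟙 (positiveFrom 1 X)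
  violation-step h X with <-cmp h d
  ... | tri< h<d _ _ rewrite ≤⇒<ᵇ≡false {d} {suc h} h<d | ≤⇒<ᵇ≡false {d} {h} (<⇒≤ h<d) | ≢⇒≡ᵇ≡false (<⇒≢ h<d) = refl
  ... | tri≈ _ refl _ rewrite <ᵇ⇒≡true (n<1+n d) | m+n∸n≡m 1 d | ≤⇒<ᵇ≡false {d} {d} ≤-refl | ≡ᵇ-refl d | ≡ᵇ-refl b =
    sym (+-identityʳ _)
  ... | tri> _ _ d<h rewrite <ᵇ⇒≡true d<h | <ᵇ⇒≡true (m<n⇒m<1+n d<h) | ≢⇒≡ᵇ≡false (>⇒≢ d<h) | +-∸-assoc 1 (<⇒≤ d<h) =
    sym (+-identityʳ _)

  -- The decomposition: a labelling by a, b that is positive is either positive for b, a too, or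
  -- it has a (first) violation point.  Both parities are proved simultaneously.
  decompose-even : ∀ p h → Even (#N p) →
    𝟙 (positiveFrom h (label a b p)) ≡ 𝟙 (positiveFrom h (label b a p)) + violations h a b p
  decompose-odd : ∀ p h → Odd (#N p) →
    𝟙 (positiveFrom h (label b a p)) ≡ 𝟙 ((d <ᵇ h) ∧ positiveFrom (h ∸ d) (label a b p)) + violations h b a p
  decompose-even [] h _ = refl
  decompose-even (E ∷ q) h even rewrite atViolation-a h = decompose-even q (suc h) even
  decompose-even (N ∷ q) h even =
    trans (𝟙-guard (a <ᵇ h) _ _ _ (λ _ → decompose-odd q (h ∸ a) (λ u v → even v u)))
          (cong (λ z → 𝟙 z + 𝟙 (a <ᵇ h) * violations (h ∸ a) b a q) guards)
    where
    guards : ((a <ᵇ h) ∧ ((d <ᵇ h ∸ a) ∧ positiveFrom (h ∸ a ∸ d) (label a b q))) ≡ ((b <ᵇ h) ∧ positiveFrom (h ∸ b) (label a b q))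
    guards = trans (sym (∧-assoc (a <ᵇ h) _ _))
      (cong₂ _∧_ (trans (cong ((a <ᵇ h) ∧_) (<ᵇ-∸ a d h)) (<ᵇ-∧-+ a d h))
                 (cong (λ z → positiveFrom z (label a b q)) (∸-+-assoc h a d)))
  decompose-odd [] h odd with () ← odd 0 1
  decompose-odd (E ∷ q) h odd = trans (decompose-odd q (suc h) odd)
    (trans (cong (_+ violations (suc h) b a q) (violation-step h (label a b q)))
           (+-assoc (𝟙 ((d <ᵇ h) ∧ positiveFrom (suc (h ∸ d)) (label a b q))) _ (violations (suc h) b a q)))
  decompose-odd (N ∷ q) h odd =
    trans (𝟙-guard (b <ᵇ h) _ _ _ (λ _ → decompose-even q (h ∸ b) (λ u v → odd v u)))
          (cong (λ z → 𝟙 z + 𝟙 (b <ᵇ h) * violations (h ∸ b) a b q) guards)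
    where
    guards : ((b <ᵇ h) ∧ positiveFrom (h ∸ b) (label b a q)) ≡ ((d <ᵇ h) ∧ ((a <ᵇ h ∸ d) ∧ positiveFrom (h ∸ d ∸ a) (label b a q)))
    guards = sym (trans (sym (∧-assoc (d <ᵇ h) _ _))
      (cong₂ _∧_ (trans (cong ((d <ᵇ h) ∧_) (<ᵇ-∸ d a h)) (trans (<ᵇ-∧-+ d a h) (cong (_<ᵇ h) (+-comm d a))))
                 (cong (λ z → positiveFrom z (label b a q)) (trans (∸-+-assoc h d a) (cong (h ∸_) (+-comm d a))))))

  violationPrefix : ℕ → ℕ → ℕ → List Step → ℕ
  violationPrefix h u v [] = 𝟙 (atViolation h u)
  violationPrefix h u v (E ∷ q) = violationPrefix (suc h) u v q
  violationPrefix h u v (N ∷ q) = 𝟙 (u <ᵇ h) * violationPrefix (h ∸ u) v u q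

  cutTail : List Step → ℕ
  cutTail [] = 0
  cutTail (E ∷ q) = goodTail q
  cutTail (N ∷ q) = 0

  violations-cuts : ∀ p h u v → violations h u v p ≡ Σ< (length p) (λ j → violationPrefix h u v (take j p) * cutTail (drop j p))
  violations-cuts [] h u v = refl
  violations-cuts (E ∷ q) h u v = trans (cong (𝟙 (atViolation h u) * goodTail q +_) (violations-cuts q (suc h) u v))
    (sym (Σ<-cons (length q) (λ j → violationPrefix h u v (take j (E ∷ q)) * cutTail (drop j (E ∷ q)))))
  violations-cuts (N ∷ q) h u v = begin
      𝟙 (u <ᵇ h) * violations (h ∸ u) v u q
        ≡⟨ cong (𝟙 (u <ᵇ h) *_) (violations-cuts q (h ∸ u) v u) ⟩
      𝟙 (u <ᵇ h) * Σ< (length q) (λ j → violationPrefix (h ∸ u) v u (take j q) * cutTail (drop j q))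
        ≡⟨ Σ<-* (length q) (𝟙 (u <ᵇ h)) _ ⟨
      Σ< (length q) (λ j → 𝟙 (u <ᵇ h) * (violationPrefix (h ∸ u) v u (take j q) * cutTail (drop j q)))
        ≡⟨ Σ<-cong (length q) (λ j _ → sym (*-assoc (𝟙 (u <ᵇ h)) _ (cutTail (drop j q)))) ⟩
      Σ< (length q) (λ j → violationPrefix h u v (take (suc j) (N ∷ q)) * cutTail (drop (suc j) (N ∷ q)))
        ≡⟨ cong (_+ Σ< (length q) (λ j → violationPrefix h u v (take (suc j) (N ∷ q)) * cutTail (drop (suc j) (N ∷ q))))
                (*-zeroʳ (𝟙 (atViolation h u))) ⟨
      violationPrefix h u v [] * cutTail (N ∷ q) + Σ< (length q) (λ j → violationPrefix h u v (take (suc j) (N ∷ q)) * cutTail (drop (suc j) (N ∷ q)))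
        ≡⟨ Σ<-cons (length q) (λ j → violationPrefix h u v (take j (N ∷ q)) * cutTail (drop j (N ∷ q))) ⟨
      Σ< (length (N ∷ q)) (λ j → violationPrefix h u v (take j (N ∷ q)) * cutTail (drop j (N ∷ q))) ∎
    where open ≡-Reasoning

  endsAtViolation : ℕ → ℕ → ℕ → List Step → Bool
  endsAtViolation h u v q = atViolation (h + #E q ∸ g u v (#N q)) (alternate (#N q) u v)

  violationPrefix-positive : ∀ q h u v → violationPrefix h u v q ≡ 𝟙 (positiveFrom h (label u v q)) * 𝟙 (endsAtViolation h u v q)
  violationPrefix-positive [] h u v =
    trans (cong (λ z → 𝟙 (atViolation z u)) (sym (+-identityʳ h))) (sym (+-identityʳ _))
  violationPrefix-positive (E ∷ q) h u v = trans (violationPrefix-positive q (suc h) u v)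
    (cong (λ z → 𝟙 (positiveFrom (suc h) (label u v q)) * 𝟙 (atViolation (z ∸ g u v (#N q)) (alternate (#N q) u v)))
          (sym (+-suc h (#E q))))
  violationPrefix-positive (N ∷ q) h u v with u <ᵇ h in u<ᵇh
  ... | false = refl
  ... | true = trans (+-identityʳ _) (trans (violationPrefix-positive q (h ∸ u) v u)
        (cong (λ z → 𝟙 (positiveFrom (h ∸ u) (label v u q)) * 𝟙 (atViolation z (alternate (#N q) v u)))
              (∸-+-shift {h} {u} (#E q) (g v u (#N q)) (<⇒≤ (≡true⇒< u<ᵇh)))))

  instance
    a+b+2-nonZero : NonZero (a + b + 2)
    a+b+2-nonZero = >-nonZero (subst (0 <_) (sym (+-comm (a + b) 2)) (s≤s z≤n))

  lengthQ-injective : ∀ {r r'} → lengthQ r ≡ lengthQ r' → r ≡ r'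
  lengthQ-injective {r} {r'} eq = *-cancelˡ-≡ r r' (a + b + 2) (+-cancelʳ-≡ b _ _ eq)

  lengthQ-mono : ∀ {r r'} → r < r' → lengthQ r < lengthQ r'
  lengthQ-mono r<r' = +-monoˡ-< b (*-monoʳ-< (a + b + 2) r<r')

  -- A word with 2r + 1 N-steps ending at height d under the labelling by a, b from height 1 has length lengthQ r.
  lengthQ-excess : ∀ r → d + g a b (suc (2 * r)) + suc (2 * r) ≡ suc (lengthQ r)
  lengthQ-excess r = trans (cong (λ z → d + z + suc (2 * r)) (g-odd a b r)) (arithmetic a d' r)
    where
    arithmetic : ∀ a d' r → suc d' + (a + r * ((a + suc d') + a)) + suc (2 * r) ≡ suc ((a + (a + suc d') + 2) * r + (a + suc d'))
    arithmetic = solve-∀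

  violationPrefix-shape : ∀ q → positiveFrom 1 (label a b q) ≡ true → endsAtViolation 1 a b q ≡ true →
                          Σ ℕ λ r → #N q ≡ suc (2 * r) × length q ≡ lengthQ r
  violationPrefix-shape q pos viol with evenOrOdd (#N q)
  ... | inj₁ (r , #N≡) = ⊥-elim (<⇒≢ (m<m+n a (s≤s z≤n)) (trans (sym (alternate-even r a b)) a≡b))
    where
    a≡b : alternate (2 * r) a b ≡ b
    a≡b = subst (λ k → alternate k a b ≡ b) #N≡ (≡true⇒≡ (∧-conicalʳ (suc (#E q) ∸ g a b (#N q) ≡ᵇ d) _ viol))
  ... | inj₂ (r , #N≡) = r , #N≡ , suc-injective (begin
      suc (length q)                       ≡⟨ cong suc (length-#E+#N q) ⟩
      suc (#E q) + #N q                    ≡⟨ cong₂ _+_ (sym end) #N≡ ⟩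
      d + g a b (#N q) + suc (2 * r)       ≡⟨ cong (λ k → d + g a b k + suc (2 * r)) #N≡ ⟩
      d + g a b (suc (2 * r)) + suc (2 * r) ≡⟨ lengthQ-excess r ⟩
      suc (lengthQ r)                      ∎)
    where
    open ≡-Reasoning
    g<#E : g a b (#N q) < suc (#E q)
    g<#E = subst₂ _<_ (weight-label a b q) (cong suc (#up-label a b q)) (positive⇒weight< 1 (label a b q) (s≤s z≤n) pos)
    end : d + g a b (#N q) ≡ suc (#E q)
    end = trans (cong (_+ g a b (#N q)) (sym (≡true⇒≡ (∧-conicalˡ (suc (#E q) ∸ g a b (#N q) ≡ᵇ d) _ viol))))
                (m∸n+n≡m (<⇒≤ g<#E))

  violationPrefix-elsewhere : ∀ q → (∀ r → length q ≢ lengthQ r) → violationPrefix 1 a b q ≡ 0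
  violationPrefix-elsewhere q off =
    trans (violationPrefix-positive q 1 a b) (indicators (positiveFrom 1 (label a b q)) (endsAtViolation 1 a b q) refl refl)
    where
    indicators : ∀ x y → positiveFrom 1 (label a b q) ≡ x → endsAtViolation 1 a b q ≡ y → 𝟙 x * 𝟙 y ≡ 0
    indicators false y _ _ = refl
    indicators true false _ _ = refl
    indicators true true pos viol with violationPrefix-shape q pos viol
    ... | r , _ , len = ⊥-elim (off r len)

  endsAtViolation-lengthQ : ∀ q r → length q ≡ lengthQ r → positiveFrom 1 (label a b q) ≡ true →
                            endsAtViolation 1 a b q ≡ (#N q ≡ᵇ suc (2 * r))
  endsAtViolation-lengthQ q r len pos with #N q ≡ᵇ suc (2 * r) in #N≡ᵇ
  ... | true = cong₂ _∧_ (≡⇒≡true height) (trans (cong (_≡ᵇ b) next) (≡ᵇ-refl b))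
    where
    open ≡-Reasoning
    #N≡ : #N q ≡ suc (2 * r)
    #N≡ = ≡true⇒≡ #N≡ᵇ
    next : alternate (#N q) a b ≡ b
    next = trans (cong (λ k → alternate k a b) #N≡) (alternate-odd r a b)
    end : suc (#E q) ≡ d + g a b (#N q)
    end = +-cancelʳ-≡ (suc (2 * r)) _ _ (begin
      suc (#E q) + suc (2 * r)               ≡⟨ cong (suc (#E q) +_) (sym #N≡) ⟩
      suc (#E q + #N q)                      ≡⟨ cong suc (sym (length-#E+#N q)) ⟩
      suc (length q)                         ≡⟨ cong suc len ⟩
      suc (lengthQ r)                        ≡⟨ lengthQ-excess r ⟨
      d + g a b (suc (2 * r)) + suc (2 * r)  ≡⟨ cong (λ k → d + g a b k + suc (2 * r)) (sym #N≡) ⟩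
      d + g a b (#N q) + suc (2 * r)         ∎)
    height : suc (#E q) ∸ g a b (#N q) ≡ d
    height = trans (cong (_∸ g a b (#N q)) end) (m+n∸n≡m d (g a b (#N q)))
  ... | false with endsAtViolation 1 a b q in viol
  ...   | false = refl
  ...   | true with violationPrefix-shape q pos viol
  ...     | r' , #N≡ , len' with () ← trans (sym #N≡ᵇ)
            (≡⇒≡true (trans #N≡ (cong (λ z → suc (2 * z)) (lengthQ-injective (trans (sym len') len)))))

  violationPrefix-lengthQ : ∀ q r → length q ≡ lengthQ r → violationPrefix 1 a b q ≡ 𝟙 (#N q ≡ᵇ suc (2 * r)) * goodTail q
  violationPrefix-lengthQ q r len =
    trans (violationPrefix-positive q 1 a b) (indicators (positiveFrom 1 (label a b q)) refl)
    where
    indicators : ∀ x → positiveFrom 1 (label a b q) ≡ x → 𝟙 x * 𝟙 (endsAtViolation 1 a b q) ≡ 𝟙 (#N q ≡ᵇ suc (2 * r)) * 𝟙 x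
    indicators false _ = sym (*-zeroʳ (𝟙 (#N q ≡ᵇ suc (2 * r))))
    indicators true pos = trans (+-identityʳ _) (trans (cong 𝟙 (endsAtViolation-lengthQ q r len pos)) (sym (*-identityʳ _)))

  -- isQ r q: q has 2r + 1 N-steps and its labelling by a, b is positive from 1.  By paths↔words,
  -- #Q r counts the paths to q_r weakly under ∂_{a,b}.
  isQ : ℕ → List Step → ℕ
  isQ r q = 𝟙 (#N q ≡ᵇ suc (2 * r)) * goodTail q

  #Q : ℕ → ℕ
  #Q r = Σw (lengthQ r) (isQ r)

  isCutTail : ℕ → List Step → ℕ
  isCutTail r t = 𝟙 (#N t ≡ᵇ suc (2 * r)) * cutTail t

  Σw-cutTail : ∀ r → Σw (suc (lengthQ r)) (isCutTail r) ≡ #Q r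
  Σw-cutTail r = trans (cong (#Q r +_) (trans (Σw-cong (lengthQ r) (λ q _ → *-zeroʳ (𝟙 (#N (N ∷ q) ≡ᵇ suc (2 * r))))) (Σw-0 (lengthQ r))))
                       (+-identityʳ (#Q r))

  -- A word counted by #P (n = r + m + 1) has room for a Q_r prefix, an E-step and a Q_m suffix.
  lengthP-split : ∀ r m → lengthP (suc (r + m)) ≡ lengthQ r + suc (lengthQ m)
  lengthP-split r m = arithmetic a d' r m
    where
    arithmetic : ∀ a d' r m → (a + (a + suc d') + 2) * suc (r + m) + d'
                            ≡ ((a + (a + suc d') + 2) * r + (a + suc d')) + suc ((a + (a + suc d') + 2) * m + (a + suc d'))
    arithmetic = solve-∀

  cut : ℕ → List Step → ℕ
  cut j p = violationPrefix 1 a b (take j p) * cutTail (drop j p)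

  cut-lengthQ : ∀ r m p → length p ≡ lengthQ r + suc (lengthQ m) →
    𝟙 (#N p ≡ᵇ 2 * suc (r + m)) * cut (lengthQ r) p ≡ isQ r (take (lengthQ r) p) * isCutTail m (drop (lengthQ r) p)
  cut-lengthQ r m p len = begin
      𝟙 (#N p ≡ᵇ 2 * suc (r + m)) * (violationPrefix 1 a b t * cutTail t')
        ≡⟨ cong₂ (λ x y → 𝟙 (x ≡ᵇ 2 * suc (r + m)) * (y * cutTail t')) #N-split (violationPrefix-lengthQ t r length-t) ⟩
      𝟙 (#N t + #N t' ≡ᵇ 2 * suc (r + m)) * (isQ r t * cutTail t')
        ≡⟨ cong (λ z → 𝟙 (#N t + #N t' ≡ᵇ z) * (isQ r t * cutTail t')) (twice r m) ⟩
      𝟙 (#N t + #N t' ≡ᵇ suc (2 * r) + suc (2 * m)) * (isQ r t * cutTail t')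
        ≡⟨ 𝟙-sum-split (#N t) (#N t') (suc (2 * r)) (suc (2 * m)) (goodTail t) (cutTail t') ⟩
      isQ r t * isCutTail m t' ∎
    where
    open ≡-Reasoning
    t = take (lengthQ r) p
    t' = drop (lengthQ r) p
    twice : ∀ r m → 2 * suc (r + m) ≡ suc (2 * r) + suc (2 * m)
    twice = solve-∀
    #N-split : #N p ≡ #N t + #N t'
    #N-split = trans (cong #N (sym (take++drop≡id (lengthQ r) p))) (#N-++ t t')
    length-t : length t ≡ lengthQ r
    length-t = trans (length-take (lengthQ r) p) (m≤n⇒m⊓n≡m (subst (lengthQ r ≤_) (sym len) (m≤m+n (lengthQ r) _)))

  cutsAt : ℕ → ℕ → ℕ
  cutsAt n j = Σw (lengthP n) (λ p → 𝟙 (#N p ≡ᵇ 2 * n) * cut j p)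

  cutsAt-lengthQ : ∀ r m → cutsAt (suc (r + m)) (lengthQ r) ≡ #Q r * #Q m
  cutsAt-lengthQ r m = begin
      cutsAt (suc (r + m)) (lengthQ r)
        ≡⟨ cong (λ L → Σw L (λ p → 𝟙 (#N p ≡ᵇ 2 * suc (r + m)) * cut (lengthQ r) p)) (lengthP-split r m) ⟩
      Σw (lengthQ r + suc (lengthQ m)) (λ p → 𝟙 (#N p ≡ᵇ 2 * suc (r + m)) * cut (lengthQ r) p)
        ≡⟨ Σw-cong (lengthQ r + suc (lengthQ m)) (cut-lengthQ r m) ⟩
      Σw (lengthQ r + suc (lengthQ m)) (λ p → isQ r (take (lengthQ r) p) * isCutTail m (drop (lengthQ r) p))
        ≡⟨ Σw-product (lengthQ r) (suc (lengthQ m)) (isQ r) (isCutTail m) ⟩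
      #Q r * Σw (suc (lengthQ m)) (isCutTail m)
        ≡⟨ cong (#Q r *_) (Σw-cutTail m) ⟩
      #Q r * #Q m ∎
    where open ≡-Reasoning

  -- Summed over the words counted by #P, the violation cuts give the convolution of the #Q:
  -- only cuts at the positions lengthQ r, r < n, contribute.
  Σw-violations : ∀ n → Σw (lengthP n) (λ p → 𝟙 (#N p ≡ᵇ 2 * n) * violations 1 a b p) ≡ Σ< n (λ r → #Q r * #Q (n ∸ 1 ∸ r))
  Σw-violations n = begin
      Σw L (λ p → 𝟙 (#N p ≡ᵇ 2 * n) * violations 1 a b p)
        ≡⟨ Σw-cong L (λ p len → trans (cong (𝟙 (#N p ≡ᵇ 2 * n) *_) (trans (violations-cuts p 1 a b) (cong (λ k → Σ< k (λ j → cut j p)) len)))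
                                      (sym (Σ<-* L (𝟙 (#N p ≡ᵇ 2 * n)) (λ j → cut j p)))) ⟩
      Σw L (λ p → Σ< L (λ j → 𝟙 (#N p ≡ᵇ 2 * n) * cut j p))
        ≡⟨ Σw-Σ< L L (λ j p → 𝟙 (#N p ≡ᵇ 2 * n) * cut j p) ⟩
      Σ< L (cutsAt n)
        ≡⟨ Σ<-reindex n L (cutsAt n) below L≤lengthQ elsewhere ⟩
      Σ< n (λ r → cutsAt n (lengthQ r))
        ≡⟨ Σ<-cong n (λ r r<n → trans (cong (λ k → cutsAt k (lengthQ r)) (n-split r r<n)) (cutsAt-lengthQ r (n ∸ 1 ∸ r))) ⟩
      Σ< n (λ r → #Q r * #Q (n ∸ 1 ∸ r)) ∎
    where
    open ≡-Reasoning
    open Reindex lengthQ lengthQ-mono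
    L = lengthP n
    n-split : ∀ r → r < n → n ≡ suc (r + (n ∸ 1 ∸ r))
    n-split r (s≤s r≤n-1) = cong suc (sym (m+[n∸m]≡n r≤n-1))
    below : ∀ r → r < n → lengthQ r < L
    below r r<n = subst (lengthQ r <_) (sym (trans (cong lengthP (n-split r r<n)) (lengthP-split r (n ∸ 1 ∸ r))))
                        (m<m+n (lengthQ r) (s≤s z≤n))
    L≤lengthQ : L ≤ lengthQ n
    L≤lengthQ = +-monoʳ-≤ ((a + b + 2) * n) (≤-trans (n≤1+n d') (m≤n+m d a))
    elsewhere : ∀ j → j < L → (∀ r → j ≢ lengthQ r) → cutsAt n j ≡ 0
    elsewhere j j<L off = trans (Σw-cong L (λ p len → cong (λ z → 𝟙 (#N p ≡ᵇ 2 * n) * (z * cutTail (drop j p)))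
        (violationPrefix-elsewhere (take j p) (λ r eq → off r (trans (sym (length-take-≤ p len)) eq)))))
      (trans (Σw-cong L (λ p _ → *-zeroʳ (𝟙 (#N p ≡ᵇ 2 * n)))) (Σw-0 L))
      where
      length-take-≤ : ∀ p → length p ≡ L → length (take j p) ≡ j
      length-take-≤ p len = trans (length-take j p) (m≤n⇒m⊓n≡m (subst (j ≤_) (sym len) (<⇒≤ j<L)))

  -- #Pab n, #Pba n: the words of length lengthP n with 2n N-steps whose labelling by a, b (resp. b, a)
  -- is positive from 1, i.e. the paths to p_n weakly under ∂_{a,b} (resp. ∂_{b,a}).
  #Pab #Pba : ℕ → ℕ
  #Pab n = Σw (lengthP n) (λ p → 𝟙 (#N p ≡ᵇ 2 * n) * 𝟙 (positiveFrom 1 (label a b p)))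
  #Pba n = Σw (lengthP n) (λ p → 𝟙 (#N p ≡ᵇ 2 * n) * 𝟙 (positiveFrom 1 (label b a p)))

  #Pab-decomposition : ∀ n → #Pab n ≡ #Pba n + Σ< n (λ r → #Q r * #Q (n ∸ 1 ∸ r))
  #Pab-decomposition n =
    trans (Σw-cong (lengthP n) pointwise) (trans (Σw-+ (lengthP n) _ _) (cong (#Pba n +_) (Σw-violations n)))
    where
    pointwise : ∀ p → length p ≡ lengthP n →
      𝟙 (#N p ≡ᵇ 2 * n) * 𝟙 (positiveFrom 1 (label a b p))
        ≡ 𝟙 (#N p ≡ᵇ 2 * n) * 𝟙 (positiveFrom 1 (label b a p)) + 𝟙 (#N p ≡ᵇ 2 * n) * violations 1 a b p
    pointwise p _ with #N p ≡ᵇ 2 * n in #N≡ᵇ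
    ... | false = refl
    ... | true = trans (+-identityʳ _) (trans (decompose-even p 1 even)
                   (cong₂ _+_ (sym (+-identityʳ (𝟙 (positiveFrom 1 (label b a p))))) (sym (+-identityʳ (violations 1 a b p)))))
      where
      even : Even (#N p)
      even u v = trans (cong (λ k → alternate k u v) (≡true⇒≡ {#N p} {2 * n} #N≡ᵇ)) (alternate-even n u v)

  -- The numbers of E-steps on the way to q_n and p_n, compared with the weights of the boundaries.
  excess-Q-ab : ∀ n → (a + b) * n + b ≡ d + g a b (suc (2 * n))
  excess-Q-ab n = trans (arithmetic a d' n) (cong (d +_) (sym (g-odd a b n)))
    where
    arithmetic : ∀ a d' n → (a + (a + suc d')) * n + (a + suc d') ≡ suc d' + (a + n * ((a + suc d') + a))
    arithmetic = solve-∀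

  excess-Q-ba : ∀ n → (a + b) * n + b ≡ g b a (suc (2 * n))
  excess-Q-ba n = trans (arithmetic a d' n) (sym (g-odd b a n))
    where
    arithmetic : ∀ a d' n → (a + (a + suc d')) * n + (a + suc d') ≡ (a + suc d') + n * (a + (a + suc d'))
    arithmetic = solve-∀

  excess-P : ∀ u v → u + v ≡ a + b → ∀ n → (a + b) * n + d ≡ d + g u v (2 * n)
  excess-P u v u+v≡ n = trans (+-comm _ d) (cong (d +_) (sym (trans (g-even u v n) (trans (cong (n *_) u+v≡) (*-comm n (a + b))))))

  suc-lengthQ : ∀ n → suc (lengthQ n) ≡ ((a + b) * n + b) + suc (2 * n)
  suc-lengthQ n = arithmetic a d' n
    where
    arithmetic : ∀ a d' n → suc ((a + (a + suc d') + 2) * n + (a + suc d')) ≡ ((a + (a + suc d')) * n + (a + suc d')) + suc (2 * n)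
    arithmetic = solve-∀

  suc-lengthP : ∀ n → suc (lengthP n) ≡ ((a + b) * n + d) + 2 * n
  suc-lengthP n = arithmetic a d' n
    where
    arithmetic : ∀ a d' n → suc ((a + (a + suc d') + 2) * n + d') ≡ ((a + (a + suc d')) * n + suc d') + 2 * n
    arithmetic = solve-∀

  rotations-Q : ∀ n w → length w ≡ suc (lengthQ n) → #N w ≡ suc (2 * n) →
                Σ< (suc (lengthQ n)) (λ i → good (label a b (rotateBy i w))) ≡ d
  rotations-Q n w len #N≡ = subst (λ L → Σ< L (λ i → good (label a b (rotateBy i w))) ≡ d) len
    (Doubling.rotations-odd a d w odd
      (trans #E≡ (trans (excess-Q-ab n) (cong (λ k → d + g a b k) (sym #N≡))))
      (trans #E≡ (trans (excess-Q-ba n) (cong (g b a) (sym #N≡)))) (s≤s z≤n))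
    where
    #E≡ : #E w ≡ (a + b) * n + b
    #E≡ = #E-from-length w (trans len (suc-lengthQ n)) #N≡
    odd : Odd (#N w)
    odd u v = trans (cong (λ k → alternate k u v) #N≡) (alternate-odd n u v)

  rotations-P : ∀ n w → length w ≡ suc (lengthP n) → #N w ≡ 2 * n →
                Σ< (suc (lengthP n)) (λ i → good (label a b (rotateBy i w)) + good (label b a (rotateBy i w))) ≡ d + d
  rotations-P n w len #N≡ = subst (λ L → Σ< L (λ i → good (label a b (rotateBy i w)) + good (label b a (rotateBy i w))) ≡ d + d) len
    (rotations-even a b d w even (excess a b refl) (excess b a (+-comm b a)) (s≤s z≤n))
    where
    #E≡ : #E w ≡ (a + b) * n + d
    #E≡ = #E-from-length w (trans len (suc-lengthP n)) #N≡
    even : Even (#N w)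
    even u v = trans (cong (λ k → alternate k u v) #N≡) (alternate-even n u v)
    excess : ∀ u v → u + v ≡ a + b → #E w ≡ d + g u v (#N w)
    excess u v u+v≡ = trans #E≡ (trans (excess-P u v u+v≡ n) (cong (λ k → d + g u v k) (sym #N≡)))

  -- The closed forms behind M_n and N_n: (c n + b) · #Q n = (b - a) · C((c+2) n + b, 2n + 1) and
  -- (c n + b - a) · (#Pab n + #Pba n) = 2 (b - a) · C((c+2) n + b - a - 1, 2n).
  #Q-closed : ∀ n → ((a + b) * n + b) * #Q n ≡ d * bin (lengthQ n) (suc (2 * n))
  #Q-closed n = divide-out (lengthQ n) ((a + b) * n + b) (#Q n) d (bin (suc (lengthQ n)) (suc (2 * n))) (bin (lengthQ n) (suc (2 * n)))
    (trans (cong (suc (lengthQ n) *_) (sym (Σw-good a b (lengthQ n) (suc (2 * n)))))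
           (Σw-by-rotations (suc (lengthQ n)) (suc (2 * n)) (λ w → good (label a b w)) d (rotations-Q n)))
    (trans (cong (_* bin (suc (lengthQ n)) (suc (2 * n))) (predecessor a d' n))
           (bin-absorb' ((a + b) * n + a + d') (suc (2 * n)) (lengthQ n) (arithmetic a d' n)))
    where
    predecessor : ∀ a d' n → (a + (a + suc d')) * n + (a + suc d') ≡ suc ((a + (a + suc d')) * n + a + d')
    predecessor = solve-∀
    arithmetic : ∀ a d' n → (a + (a + suc d')) * n + a + d' + suc (2 * n) ≡ (a + (a + suc d') + 2) * n + (a + suc d')
    arithmetic = solve-∀

  #P-closed : ∀ n → ((a + b) * n + d) * (#Pab n + #Pba n) ≡ (d + d) * bin (lengthP n) (2 * n)
  #P-closed n = divide-out (lengthP n) ((a + b) * n + d) (#Pab n + #Pba n) (d + d) (bin (suc (lengthP n)) (2 * n)) (bin (lengthP n) (2 * n))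
    (trans (cong (suc (lengthP n) *_) both) (Σw-by-rotations (suc (lengthP n)) (2 * n) goodBoth (d + d) (rotations-P n)))
    (trans (cong (_* bin (suc (lengthP n)) (2 * n)) (+-suc ((a + b) * n) d'))
           (bin-absorb' ((a + b) * n + d') (2 * n) (lengthP n) (arithmetic a d' n)))
    where
    goodBoth : List Step → ℕ
    goodBoth w = good (label a b w) + good (label b a w)
    filtered : (List Step → ℕ) → ℕ
    filtered f = Σw (suc (lengthP n)) (λ w → 𝟙 (#N w ≡ᵇ 2 * n) * f w)
    both : #Pab n + #Pba n ≡ filtered goodBoth
    both = begin
      #Pab n + #Pba n                                         ≡⟨ cong₂ _+_ (Σw-good a b (lengthP n) (2 * n)) (Σw-good b a (lengthP n) (2 * n)) ⟨
      filtered (λ w → good (label a b w)) + filtered (λ w → good (label b a w))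
        ≡⟨ Σw-+ (suc (lengthP n)) (λ w → 𝟙 (#N w ≡ᵇ 2 * n) * good (label a b w)) (λ w → 𝟙 (#N w ≡ᵇ 2 * n) * good (label b a w)) ⟨
      Σw (suc (lengthP n)) (λ w → 𝟙 (#N w ≡ᵇ 2 * n) * good (label a b w) + 𝟙 (#N w ≡ᵇ 2 * n) * good (label b a w))
        ≡⟨ Σw-cong (suc (lengthP n)) (λ w _ → sym (*-distribˡ-+ (𝟙 (#N w ≡ᵇ 2 * n)) (good (label a b w)) (good (label b a w)))) ⟩
      filtered goodBoth                                       ∎
      where open ≡-Reasoning
    arithmetic : ∀ a d' n → (a + (a + suc d')) * n + d' + 2 * n ≡ (a + (a + suc d') + 2) * n + d'
    arithmetic = solve-∀

  -- The coordinates of the endpoints: q_n = (xQ n, 2n + 1) and p_n = (xP n, 2n).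
  xQ xP : ℕ → ℕ
  xQ n = (a + b) * n + a + d'
  xP n = (a + b) * n + d'

  suc-xQ : ∀ n → (a + b) * n + b ≡ suc (xQ n)
  suc-xQ n = arithmetic a d' n
    where
    arithmetic : ∀ a d' n → (a + (a + suc d')) * n + (a + suc d') ≡ suc ((a + (a + suc d')) * n + a + d')
    arithmetic = solve-∀

  suc-xP : ∀ n → (a + b) * n + b ∸ a ≡ suc (xP n)
  suc-xP n = trans (cong (_∸ a) (arithmetic a d' n)) (trans (m+n∸m≡n a _) (+-suc _ d'))
    where
    arithmetic : ∀ a d' n → (a + (a + suc d')) * n + (a + suc d') ≡ a + ((a + (a + suc d')) * n + suc d')
    arithmetic = solve-∀

  xQ-length : ∀ n → (a + b) * n + b ∸ 1 + (2 * n + 1) ≡ lengthQ n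
  xQ-length n = trans (cong₂ _+_ (cong (_∸ 1) (suc-xQ n)) (+-comm (2 * n) 1)) (arithmetic a d' n)
    where
    arithmetic : ∀ a d' n → (a + (a + suc d')) * n + a + d' + suc (2 * n) ≡ (a + (a + suc d') + 2) * n + (a + suc d')
    arithmetic = solve-∀

  xP-length : ∀ n → (a + b) * n + b ∸ a ∸ 1 + 2 * n ≡ lengthP n
  xP-length n = trans (cong (λ x → x ∸ 1 + 2 * n) (suc-xP n)) (arithmetic a d' n)
    where
    arithmetic : ∀ a d' n → (a + (a + suc d')) * n + d' + 2 * n ≡ (a + (a + suc d') + 2) * n + d'
    arithmetic = solve-∀

  b∸a≡d : b ∸ a ≡ d
  b∸a≡d = m+n∸m≡n a d

  M-value : ∀ n → ℕtoℚ (#Q n) ≡ M a b n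
  M-value n = begin
      ℕtoℚ (#Q n)
        ≡⟨ ℕtoℚ-quotient (#Q n) d (xQ n) (bin (lengthQ n) (suc (2 * n))) (trans (cong (_* #Q n) (sym (suc-xQ n))) (#Q-closed n)) ⟩
      (d ÷ℕ suc (xQ n)) *ℚ ℕtoℚ (bin (lengthQ n) (suc (2 * n)))
        ≡⟨ cong₂ (λ x y → x *ℚ ℕtoℚ y) (cong₂ _÷ℕ_ (sym b∸a≡d) (sym (suc-xQ n)))
                 (trans (bin≡C (lengthQ n) (suc (2 * n))) (cong (lengthQ n C_) (+-comm 1 (2 * n)))) ⟩
      M a b n ∎
    where open ≡-Reasoning

  N-value : ∀ n → Nn a b n ≡ (d ÷ℕ suc (xP n)) *ℚ ℕtoℚ (bin (lengthP n) (2 * n))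
  N-value n = cong₂ (λ x y → x *ℚ ℕtoℚ y) (cong₂ _÷ℕ_ b∸a≡d (suc-xP n))
    (trans (cong (λ L → (L ∸ 1) C (2 * n)) (trans (cong (_∸ a) (arithmetic a d' n)) (trans (m+n∸m≡n a _) (+-suc _ d'))))
           (sym (bin≡C (lengthP n) (2 * n))))
    where
    arithmetic : ∀ a d' n → (a + (a + suc d') + 2) * n + (a + suc d') ≡ a + ((a + (a + suc d') + 2) * n + suc d')
    arithmetic = solve-∀

  convolution : ℕ → ℕ
  convolution n = Σ< n (λ r → #Q r * #Q (n ∸ 1 ∸ r))

  convM-value : ∀ n → convM a b n ≡ ℕtoℚ (convolution n)
  convM-value n = sumℚ-upTo n (λ i → M a b i *ℚ M a b (n ∸ 1 ∸ i)) (λ r → #Q r * #Q (n ∸ 1 ∸ r))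
    (λ i _ → trans (cong₂ _*ℚ_ (sym (M-value i)) (sym (M-value (n ∸ 1 ∸ i)))) (sym (ℕtoℚ-* (#Q i) (#Q (n ∸ 1 ∸ i)))))

  #Pab-equation : ∀ n → suc (xP n) * (2 * #Pab n) ≡ 2 * (d * bin (lengthP n) (2 * n)) + suc (xP n) * convolution n
  #Pab-equation n = solve-P (suc (xP n)) (#Pab n) (#Pba n) (convolution n) (bin (lengthP n) (2 * n)) (#Pab-decomposition n) (trans (cong (_* (#Pab n + #Pba n)) (sym (+-suc ((a + b) * n) d'))) (#P-closed n))
    where
    solve-P : ∀ D pa pb cv B → pa ≡ pb + cv → D * (pa + pb) ≡ (d + d) * B → D * (2 * pa) ≡ 2 * (d * B) + D * cv
    solve-P D _ pb cv B refl total = trans (arithmetic₁ D pb cv) (trans (cong (_+ D * cv) total) (arithmetic₂ d B (D * cv)))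
      where
      arithmetic₁ : ∀ D pb cv → D * (2 * (pb + cv)) ≡ D * (pb + cv + pb) + D * cv
      arithmetic₁ = solve-∀
      arithmetic₂ : ∀ d B x → (d + d) * B + x ≡ 2 * (d * B) + x
      arithmetic₂ = solve-∀

  #Pba-equation : ∀ n → suc (xP n) * (2 * #Pba n + convolution n) ≡ 2 * (d * bin (lengthP n) (2 * n))
  #Pba-equation n = solve-P (suc (xP n)) (#Pab n) (#Pba n) (convolution n) (bin (lengthP n) (2 * n)) (#Pab-decomposition n) (trans (cong (_* (#Pab n + #Pba n)) (sym (+-suc ((a + b) * n) d'))) (#P-closed n))
    where
    solve-P : ∀ D pa pb cv B → pa ≡ pb + cv → D * (pa + pb) ≡ (d + d) * B → D * (2 * pb + cv) ≡ 2 * (d * B)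
    solve-P D _ pb cv B refl total = trans (arithmetic₁ D pb cv) (trans total (arithmetic₂ d B))
      where
      arithmetic₁ : ∀ D pb cv → D * (2 * pb + cv) ≡ D * (pb + cv + pb)
      arithmetic₁ = solve-∀
      arithmetic₂ : ∀ d B → (d + d) * B ≡ 2 * (d * B)
      arithmetic₂ = solve-∀

  count-Q-ab : ∀ n → HasCard (Paths a b ((a + b) * n + b ∸ 1) (2 * n + 1)) (M a b n)
  count-Q-ab n = pathCount a b _ (2 * n + 1) (lengthQ n) (xQ-length n)
    (Σw-cong (lengthQ n) (λ p _ → cong (λ k → 𝟙 (#N p ≡ᵇ k) * goodTail p) (+-comm (2 * n) 1))) (M-value n)

  count-Q-ba : ∀ n → HasCard (Paths b a ((a + b) * n + b ∸ 1) (2 * n + 1)) (ℕtoℚ 0)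
  count-Q-ba n = pathCount b a _ (2 * n + 1) (lengthQ n) (xQ-length n)
    (trans (Σw-cong (lengthQ n) none) (Σw-0 (lengthQ n))) refl
    where
    -- The labelling by b, a ends exactly at height 0, so it is never positive.
    none : ∀ p → length p ≡ lengthQ n → 𝟙 (#N p ≡ᵇ 2 * n + 1) * 𝟙 (positiveFrom 1 (label b a p)) ≡ 0
    none p len with #N p ≡ᵇ 2 * n + 1 in #N≡ᵇ | positiveFrom 1 (label b a p) in pos
    ... | false | _ = refl
    ... | true | false = refl
    ... | true | true = ⊥-elim (<-irrefl weight≡ (positive⇒weight< 1 (label b a p) (s≤s z≤n) pos))
      where
      #N≡ : #N p ≡ suc (2 * n)
      #N≡ = trans (≡true⇒≡ {#N p} {2 * n + 1} #N≡ᵇ) (+-comm (2 * n) 1)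
      #E≡ : #E p ≡ (a + b) * n + b ∸ 1
      #E≡ = #E-from-length p (trans len (sym (xQ-length n))) (≡true⇒≡ {#N p} {2 * n + 1} #N≡ᵇ)
      weight≡ : weight (label b a p) ≡ 1 + #up (label b a p)
      weight≡ = begin
        weight (label b a p)       ≡⟨ weight-label b a p ⟩
        g b a (#N p)               ≡⟨ cong (g b a) #N≡ ⟩
        g b a (suc (2 * n))        ≡⟨ excess-Q-ba n ⟨
        (a + b) * n + b            ≡⟨ suc-xQ n ⟩
        suc (xQ n)                 ≡⟨ cong suc (trans (cong (_∸ 1) (sym (suc-xQ n))) (sym #E≡)) ⟩
        suc (#E p)                 ≡⟨ cong suc (#up-label b a p) ⟨
        1 + #up (label b a p)      ∎
        where open ≡-Reasoning

  count-P-ab : ∀ n → HasCard (Paths a b ((a + b) * n + b ∸ a ∸ 1) (2 * n)) (Nn a b n +ℚ ½ *ℚ convM a b n)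
  count-P-ab n = pathCount a b _ (2 * n) (lengthP n) (xP-length n) refl
    (trans (ℕtoℚ-quotient-plus-half (#Pab n) (convolution n) d (xP n) (bin (lengthP n) (2 * n)) (#Pab-equation n))
           (sym (cong₂ (λ x y → x +ℚ ½ *ℚ y) (N-value n) (convM-value n))))

  count-P-ba : ∀ n → HasCard (Paths b a ((a + b) * n + b ∸ a ∸ 1) (2 * n)) (Nn a b n -ℚ ½ *ℚ convM a b n)
  count-P-ba n = pathCount b a _ (2 * n) (lengthP n) (xP-length n) refl
    (trans (ℚ-move (ℕtoℚ (#Pba n)) (½ *ℚ ℕtoℚ (convolution n)) _
             (ℕtoℚ-plus-half-quotient (#Pba n) (convolution n) d (xP n) (bin (lengthP n) (2 * n)) (#Pba-equation n)))
           (sym (cong₂ (λ x y → x -ℚ ½ *ℚ y) (N-value n) (convM-value n))))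

Theorem4Counts : ℕ → ℕ → ℕ → Set
Theorem4Counts a b n =
    HasCard (Paths a b ((a + b) * n + b ∸ 1) (2 * n + 1)) (M a b n)
  × HasCard (Paths b a ((a + b) * n + b ∸ 1) (2 * n + 1)) (ℕtoℚ 0)
  × HasCard (Paths a b ((a + b) * n + b ∸ a ∸ 1) (2 * n)) (Nn a b n +ℚ ½ *ℚ convM a b n)
  × HasCard (Paths b a ((a + b) * n + b ∸ a ∸ 1) (2 * n)) (Nn a b n -ℚ ½ *ℚ convM a b n)

theorem4 : (a b : ℕ) → a < b → (n : ℕ) →
    HasCard (Paths a b ((a + b) * n + b ∸ 1) (2 * n + 1)) (M a b n)
    × HasCard (Paths b a ((a + b) * n + b ∸ 1) (2 * n + 1)) (ℕtoℚ 0)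
    × HasCard (Paths a b ((a + b) * n + b ∸ a ∸ 1) (2 * n)) (Nn a b n +ℚ ½ *ℚ convM a b n)
    × HasCard (Paths b a ((a + b) * n + b ∸ a ∸ 1) (2 * n)) (Nn a b n -ℚ ½ *ℚ convM a b n)
theorem4 a b a<b n = subst (λ b → Theorem4Counts a b n) b≡ counts
  where
  d' : ℕ
  d' = b ∸ suc a
  b≡ : a + suc d' ≡ b
  b≡ = trans (+-suc a d') (m+[n∸m]≡n a<b)
  open FixedWeights a d'
  counts : Theorem4Counts a (a + suc d') n
  counts = count-Q-ab n , count-Q-ba n , count-P-ab n , count-P-ba n
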